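{- Let $\ell\ge1$, $0\le k\le\ell$, $B=(b_1,\ldots,b_\ell)$ with integers $b_i\ge2$. Then the set $\{\mathbf z^{\ell,n}_{v'}: v'\in V'_{\ell,n;B},\ k<n\le\ell\}$ is a basis for the null space of the matrix $A_{\ell,k;B}^{\top}A_{\ell,k;B}$.
   Context: For an integer $b\ge2$ let $\Sigma_b=\{0,\ldots,b-1\}$, $\Delta_b=\Sigma_b\cup\{g\}$ with $g$ a gap symbol, $\Gamma_b=\Delta_b\setminus\{0\}$; $\Sigma_B,\Delta_B,\Gamma_B$ are the products over $b_1,\ldots,b_\ell$, elements written as words $v_1\cdots v_\ell$. For $v\in\Delta_B$, $G_v=\{i: v_i=g\}$. $V_{\ell,k;B}=\{v\in\Delta_B:|G_v|=\ell-k\}$, $V'_{\ell,n;B}=\{v\in\Gamma_B:|G_v|=\ell-n\}$. $u\in\Sigma_B$ and $v\in\Delta_B$ match if $u_i=v_i$ whenever $v_i\ne g$. $A_{\ell,k;B}$ is the $(0,1)$ matrix with rows indexed by $V_{\ell,k;B}$, columns indexed by $\Sigma_B$, and entry $1$ at $(v,u)$ iff $u$ and $v$ match. On $\Delta_{b_i}$ use the order $0\prec1\prec\cdots\prec b_i-1\prec g$, and set $\nu_i(x,y)=-b_i$ if $x=y=g$; $-y$ if $x=y\ne g$; $1$ if $x\prec y$; $0$ if $y\prec x$; $\nu_B(x,y)=\prod_i\nu_i(x_i,y_i)$. For $v'\in V'_{\ell,n;B}$, $\mathbf z^{\ell,n}_{v'}$ is the vector indexed by $\Sigma_B$ with entries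 $\mathbf z^{\ell,n}_{v'}(u)=\nu_B(u,v')$. -}

module Defs where

open import Data.Nat as ℕ using (ℕ; zero; suc; _∸_; _<_; _<ᵇ_)
open import Data.Fin using (Fin; toℕ)
open import Data.Fin.Properties using () renaming (_≟_ to _≟F_)
open import Data.Vec using (Vec; []; _∷_)
open import Data.List as List using (List; []; _∷_; allFin; concatMap; cartesianProductWith; filter)
open import Data.Maybe using (Maybe; just; nothing)
open import Data.Product using (_×_; _,_)
open import Data.Bool using (Bool; true; false; if_then_else_; _∧_; not; T?)
open import Data.Unit using (⊤; tt)
open import Data.Integer using (+_)
open import Data.Rational using (ℚ; 0ℚ; 1ℚ; _+_; _*_; -_; _/_)
open import Relation.Nullary.Decidable using (⌊_⌋; yes; no)
open import Relation.Binary.PropositionalEquality using (_≡_)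

-- Symbols of Δ_b : just j is the digit j ∈ Σ_b, nothing is the gap symbol g.
Δsym : ℕ → Set
Δsym b = Maybe (Fin b)

ΣW : ∀ {ℓ} → Vec ℕ ℓ → Set
ΣW []      = ⊤
ΣW (b ∷ B) = Fin b × ΣW B

ΔW : ∀ {ℓ} → Vec ℕ ℓ → Set
ΔW []      = ⊤
ΔW (b ∷ B) = Δsym b × ΔW B

allΔsym : (b : ℕ) → List (Δsym b)
allΔsym b = nothing ∷ List.map just (allFin b)

allΣ : ∀ {ℓ} (B : Vec ℕ ℓ) → List (ΣW B)
allΣ []      = tt ∷ []
allΣ (b ∷ B) = cartesianProductWith _,_ (allFin b) (allΣ B)

allΔ : ∀ {ℓ} (B : Vec ℕ ℓ) → List (ΔW B)
allΔ []      = tt ∷ []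
allΔ (b ∷ B) = cartesianProductWith _,_ (allΔsym b) (allΔ B)

nGaps : ∀ {ℓ} {B : Vec ℕ ℓ} → ΔW B → ℕ
nGaps {B = []}    tt              = 0
nGaps {B = b ∷ B} (nothing , v)   = suc (nGaps v)
nGaps {B = b ∷ B} (just _ , v)    = nGaps v

isΓ : ∀ {ℓ} {B : Vec ℕ ℓ} → ΔW B → Bool
isΓ {B = []}    tt            = true
isΓ {B = b ∷ B} (nothing , v) = isΓ v
isΓ {B = b ∷ B} (just j , v)  = not (toℕ j ℕ.≡ᵇ 0) ∧ isΓ v

V : ∀ {ℓ} (k : ℕ) (B : Vec ℕ ℓ) → List (ΔW B)
V {ℓ} k B = filter (λ v → nGaps v ℕ.≟ (ℓ ∸ k)) (allΔ B)

V' : ∀ {ℓ} (n : ℕ) (B : Vec ℕ ℓ) → List (ΔW B)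
V' {ℓ} n B = filter (λ v → T? (isΓ v ∧ (nGaps v ℕ.≡ᵇ (ℓ ∸ n)))) (allΔ B)

matches : ∀ {ℓ} {B : Vec ℕ ℓ} → ΣW B → ΔW B → Bool
matches {B = []}    tt       tt             = true
matches {B = b ∷ B} (x , u)  (nothing , v)  = matches u v
matches {B = b ∷ B} (x , u)  (just y , v)   = ⌊ x ≟F y ⌋ ∧ matches u v

sumℚ : {A : Set} → List A → (A → ℚ) → ℚ
sumℚ []       f = 0ℚ
sumℚ (x ∷ xs) f = f x + sumℚ xs f

Amat : ∀ {ℓ} (k : ℕ) (B : Vec ℕ ℓ) → ΔW B → ΣW B → ℚ
Amat k B v u = if matches u v then 1ℚ else 0ℚ

AtA : ∀ {ℓ} (k : ℕ) (B : Vec ℕ ℓ) → ΣW B → ΣW B → ℚ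
AtA k B u w = sumℚ (V k B) (λ v → Amat k B v u * Amat k B v w)

VecΣ : ∀ {ℓ} → Vec ℕ ℓ → Set
VecΣ B = ΣW B → ℚ

InNull : ∀ {ℓ} (k : ℕ) (B : Vec ℕ ℓ) → VecΣ B → Set
InNull k B x = ∀ u → sumℚ (allΣ B) (λ w → AtA k B u w * x w) ≡ 0ℚ

-- Order on Δ_b : 0 ≺ 1 ≺ … ≺ b-1 ≺ g, via rank.
rank : ∀ {b} → Δsym b → ℕ
rank {b} nothing  = b
rank     (just j) = toℕ j

ℕtoℚ : ℕ → ℚ
ℕtoℚ n = + n / 1

ν : ∀ {b} → Δsym b → Δsym b → ℚ
ν {b} nothing  nothing  = - ℕtoℚ b
ν     (just x) (just y) with x ≟F y
... | yes _ = - ℕtoℚ (toℕ y)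
... | no _  = if toℕ x <ᵇ toℕ y then 1ℚ else 0ℚ
ν     x        y        = if rank x <ᵇ rank y then 1ℚ else 0ℚ

embed : ∀ {ℓ} {B : Vec ℕ ℓ} → ΣW B → ΔW B
embed {B = []}    tt      = tt
embed {B = b ∷ B} (x , u) = just x , embed u

νB : ∀ {ℓ} {B : Vec ℕ ℓ} → ΔW B → ΔW B → ℚ
νB {B = []}    tt      tt      = 1ℚ
νB {B = b ∷ B} (x , u) (y , v) = ν x y * νB u v

-- z^{ℓ,n}_{v'}(u) = ν_B(u,v')  (n is determined by v', it is not used in the formula)
z : ∀ {ℓ} {B : Vec ℕ ℓ} (n : ℕ) → ΔW B → VecΣ B
z n v' u = νB (embed u) v'

indexSet : ∀ {ℓ} (k : ℕ) (B : Vec ℕ ℓ) → List (ℕ × ΔW B)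
indexSet {ℓ} k B =
  concatMap (λ n → List.map (n ,_) (V' n B))
            (filter (λ n → T? (k <ᵇ n)) (List.upTo (suc ℓ)))

lincomb : ∀ {ℓ} (k : ℕ) (B : Vec ℕ ℓ) → (ℕ → ΔW B → ℚ) → VecΣ B
lincomb k B c u = sumℚ (indexSet k B) (λ { (n , v') → c n v' * z n v' u })

-- For a single coordinate the vectors a ↦ ν(a, y), y ∈ Δ_b, are pairwise orthogonal, with
-- squared norms b (y = g) and c(c+1) (y = c), and they satisfy the completeness relation
-- Σ_y ν(a,y) ν(a',y) w(y) = [a = a'] for w(g) = 1/b, w(c) = 1/c − 1/(c+1).  As ν_B is a product,
-- the same holds for the vectors z_v (v ∈ Δ_B) on Σ_B, and z_v = 0 unless v ∈ Γ_B.
-- If v' has fewer gaps than a row v of A then (A z_{v'})_v = 0: at a gap of v facing a digit c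
-- of v' the factor Σ_a ν(a, c) vanishes.  Conversely AᵀA x = 0 forces A x = 0 (sum of squares),
-- so x sums to 0 over every pattern with at least ℓ − k gaps (fill gaps one at a time).  Each z_v
-- is a combination of indicators of patterns with the same gaps as v, so x is orthogonal to
-- every z_v with at least ℓ − k gaps, and completeness expands x over the remaining z_v.
-- Independence is orthogonality together with the non-vanishing of the norms on Γ_B.

module Submission where

open import Defs
open import Data.Nat as ℕ using (ℕ; zero; suc; _≤_; _<_; _∸_; z≤n; s≤s; _<ᵇ_; _≡ᵇ_)
import Data.Nat.Properties as ℕP
open import Data.Fin as F using (Fin; toℕ)
import Data.Fin.Properties as FP
open import Data.Vec using (Vec; []; _∷_)
open import Data.Vec.Relation.Unary.All as AllV using (All; []; _∷_)
open import Data.Product using (_×_; _,_; ∃; proj₁; proj₂)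
open import Data.Sum using (_⊎_; inj₁; inj₂)
open import Data.Integer as ℤ using (1ℤ)
import Data.Integer.Properties as ℤP
open import Data.Rational as Q using (ℚ; 0ℚ; 1ℚ; _+_; _*_; -_; mkℚ; 1/_)
open import Data.Rational.Properties
import Data.Rational.Unnormalised.Properties as ℚᵘP
open import Data.Rational.Unnormalised.Base using (*≡*)
import Data.Nat.Coprimality as C
open import Data.List as L using (List; []; _∷_; _++_; map; concatMap; cartesianProductWith; filter; allFin; upTo)
import Data.List.Properties as LP
open import Data.List.Membership.Propositional using (_∈_)
open import Data.List.Membership.Propositional.Properties
open import Data.List.Relation.Unary.Any using (here; there)
open import Data.Bool using (Bool; true; false; if_then_else_; _∧_; not; T; T?)
import Data.Bool.Properties as BP
open import Data.Maybe using (just; nothing)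
open import Data.Unit using (tt)
open import Data.Empty using (⊥-elim)
open import Relation.Nullary using (¬_; yes; no; does)
open import Relation.Nullary.Decidable using (⌊_⌋; dec⇒maybe)
open import Relation.Unary using (Pred; Decidable)
open import Relation.Binary.PropositionalEquality
open import Relation.Binary.Definitions using (tri<; tri≈; tri>)
import Tactic.RingSolver.Core.AlmostCommutativeRing as ACR
open import Tactic.RingSolver using (solve-∀)

ℚ-ring : ACR.AlmostCommutativeRing _ _
ℚ-ring = ACR.fromCommutativeRing +-*-commutativeRing (λ x → dec⇒maybe (0ℚ ≟ x))

χ : Bool → ℚ
χ b = if b then 1ℚ else 0ℚ

χ-∧ : ∀ p q → χ (p ∧ q) ≡ χ p * χ q
χ-∧ true  q = sym (*-identityˡ (χ q))
χ-∧ false q = sym (*-zeroˡ (χ q))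

normalℕ : ℕ → ℚ
normalℕ n = mkℚ (ℤ.+ n) 0 (C.sym (C.1-coprimeTo n))

ℕtoℚ≡normalℕ : ∀ n → ℕtoℚ n ≡ normalℕ n
ℕtoℚ≡normalℕ n = normalize-coprime (C.sym (C.1-coprimeTo n))

ℕtoℚ-suc : ∀ m → ℕtoℚ (suc m) ≡ 1ℚ + ℕtoℚ m
ℕtoℚ-suc m rewrite ℕtoℚ≡normalℕ (suc m) | ℕtoℚ≡normalℕ m | ℕtoℚ≡normalℕ 1 =
  toℚᵘ-injective (ℚᵘP.≃-trans (*≡* numerators) (ℚᵘP.≃-sym (toℚᵘ-homo-+ (normalℕ 1) (normalℕ m))))
  where
  numerators : (ℤ.+ suc m) ℤ.* 1ℤ ≡ (1ℤ ℤ.* 1ℤ ℤ.+ (ℤ.+ m) ℤ.* 1ℤ) ℤ.* 1ℤ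
  numerators rewrite ℤP.*-identityʳ (ℤ.+ suc m) | ℤP.*-identityʳ (ℤ.+ m) | ℤP.*-identityʳ (1ℤ ℤ.+ ℤ.+ m) = refl

ℕtoℚ-suc≢0 : ∀ n → ℕtoℚ (suc n) ≢ 0ℚ
ℕtoℚ-suc≢0 n eq with trans (sym (ℕtoℚ≡normalℕ (suc n))) eq
... | ()

recip : ℕ → ℚ
recip zero    = 0ℚ
recip (suc n) = 1/ normalℕ (suc n)

ℕtoℚ*recip : ∀ n → ℕtoℚ (suc n) * recip (suc n) ≡ 1ℚ
ℕtoℚ*recip n rewrite ℕtoℚ≡normalℕ (suc n) = *-inverseʳ (normalℕ (suc n))

p*q≡0⇒p≡0∨q≡0 : ∀ p q → p * q ≡ 0ℚ → p ≡ 0ℚ ⊎ q ≡ 0ℚ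
p*q≡0⇒p≡0∨q≡0 p q eq with p ≟ 0ℚ
... | yes p≡0 = inj₁ p≡0
... | no p≢0 = inj₂ (begin
    q                ≡⟨ sym (*-identityˡ q) ⟩
    1ℚ * q           ≡⟨ cong (_* q) (sym (*-inverseˡ p)) ⟩
    (1/ p * p) * q   ≡⟨ *-assoc (1/ p) p q ⟩
    1/ p * (p * q)   ≡⟨ cong (1/ p *_) eq ⟩
    1/ p * 0ℚ        ≡⟨ *-zeroʳ (1/ p) ⟩
    0ℚ               ∎)
  where
  open ≡-Reasoning
  instance _ = Q.≢-nonZero p≢0

*-zeroʳ-≡ : ∀ p {q} → q ≡ 0ℚ → p * q ≡ 0ℚ
*-zeroʳ-≡ p refl = *-zeroʳ p

square-nonneg : ∀ p → 0ℚ Q.≤ p * p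
square-nonneg p@(mkℚ (ℤ.+ _)       _ _) = nonNegative⁻¹ (p * p) {{nonNeg*nonNeg⇒nonNeg p p}}
square-nonneg p@(mkℚ ℤ.-[1+ _ ] _ _) = nonNegative⁻¹ (p * p) {{nonPos*nonPos⇒nonPos p p}}

square≡0 : ∀ p → p * p ≡ 0ℚ → p ≡ 0ℚ
square≡0 p eq with p*q≡0⇒p≡0∨q≡0 p p eq
... | inj₁ p≡0 = p≡0
... | inj₂ p≡0 = p≡0

nonneg+nonneg≡0 : ∀ {p q} → 0ℚ Q.≤ p → 0ℚ Q.≤ q → p + q ≡ 0ℚ → p ≡ 0ℚ × q ≡ 0ℚ
nonneg+nonneg≡0 {p} {q} p≥0 q≥0 eq =
  ≤-antisym (≤-trans (≤-trans (≤-reflexive (sym (+-identityʳ p))) (+-monoʳ-≤ p q≥0)) (≤-reflexive eq)) p≥0 ,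
  ≤-antisym (≤-trans (≤-trans (≤-reflexive (sym (+-identityˡ q))) (+-monoˡ-≤ q p≥0)) (≤-reflexive eq)) q≥0

module _ {A : Set} where

  sumℚ-cong : (xs : List A) {f g : A → ℚ} → (∀ x → f x ≡ g x) → sumℚ xs f ≡ sumℚ xs g
  sumℚ-cong []       f≡g = refl
  sumℚ-cong (x ∷ xs) f≡g = cong₂ _+_ (f≡g x) (sumℚ-cong xs f≡g)

  sumℚ-cong-∈ : (xs : List A) {f g : A → ℚ} → (∀ x → x ∈ xs → f x ≡ g x) → sumℚ xs f ≡ sumℚ xs g
  sumℚ-cong-∈ []       f≡g = refl
  sumℚ-cong-∈ (x ∷ xs) f≡g = cong₂ _+_ (f≡g x (here refl)) (sumℚ-cong-∈ xs (λ y y∈xs → f≡g y (there y∈xs)))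

  sumℚ-zero-∈ : (xs : List A) {f : A → ℚ} → (∀ x → x ∈ xs → f x ≡ 0ℚ) → sumℚ xs f ≡ 0ℚ
  sumℚ-zero-∈ []       f≡0 = refl
  sumℚ-zero-∈ (x ∷ xs) f≡0 =
    trans (cong₂ _+_ (f≡0 x (here refl)) (sumℚ-zero-∈ xs (λ y y∈xs → f≡0 y (there y∈xs)))) (+-identityˡ 0ℚ)

  sumℚ-zero : (xs : List A) {f : A → ℚ} → (∀ x → f x ≡ 0ℚ) → sumℚ xs f ≡ 0ℚ
  sumℚ-zero xs f≡0 = sumℚ-zero-∈ xs (λ x _ → f≡0 x)

  sumℚ-+ : (xs : List A) (f g : A → ℚ) → sumℚ xs (λ x → f x + g x) ≡ sumℚ xs f + sumℚ xs g
  sumℚ-+ []       f g = sym (+-identityˡ 0ℚ)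
  sumℚ-+ (x ∷ xs) f g = trans (cong ((f x + g x) +_) (sumℚ-+ xs f g)) (interchange (f x) (g x) _ _)
    where
    interchange : ∀ a b c d → (a + b) + (c + d) ≡ (a + c) + (b + d)
    interchange = solve-∀ ℚ-ring

  sumℚ-*ˡ : (xs : List A) (c : ℚ) (f : A → ℚ) → sumℚ xs (λ x → c * f x) ≡ c * sumℚ xs f
  sumℚ-*ˡ []       c f = sym (*-zeroʳ c)
  sumℚ-*ˡ (x ∷ xs) c f = trans (cong (c * f x +_) (sumℚ-*ˡ xs c f)) (sym (*-distribˡ-+ c (f x) _))

  sumℚ-*ʳ : (xs : List A) (c : ℚ) (f : A → ℚ) → sumℚ xs (λ x → f x * c) ≡ sumℚ xs f * c
  sumℚ-*ʳ []       c f = sym (*-zeroˡ c)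
  sumℚ-*ʳ (x ∷ xs) c f = trans (cong (f x * c +_) (sumℚ-*ʳ xs c f)) (sym (*-distribʳ-+ c (f x) _))

  sumℚ-++ : (xs ys : List A) (f : A → ℚ) → sumℚ (xs ++ ys) f ≡ sumℚ xs f + sumℚ ys f
  sumℚ-++ []       ys f = sym (+-identityˡ _)
  sumℚ-++ (x ∷ xs) ys f = trans (cong (f x +_) (sumℚ-++ xs ys f)) (sym (+-assoc (f x) _ _))

  sumℚ-filter : ∀ {p} {P : Pred A p} (P? : Decidable P) (xs : List A) (f : A → ℚ) →
                sumℚ (filter P? xs) f ≡ sumℚ xs (λ x → χ (does (P? x)) * f x)
  sumℚ-filter P? []       f = refl
  sumℚ-filter P? (x ∷ xs) f with does (P? x)
  ... | true  = cong₂ _+_ (sym (*-identityˡ (f x))) (sumℚ-filter P? xs f)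
  ... | false = trans (sumℚ-filter P? xs f) (sym (trans (cong (_+ _) (*-zeroˡ (f x))) (+-identityˡ _)))

  sumℚ-nonneg : (xs : List A) (f : A → ℚ) → (∀ x → 0ℚ Q.≤ f x) → 0ℚ Q.≤ sumℚ xs f
  sumℚ-nonneg []       f f≥0 = ≤-refl
  sumℚ-nonneg (x ∷ xs) f f≥0 =
    ≤-trans (≤-reflexive (sym (+-identityˡ 0ℚ))) (+-mono-≤ (f≥0 x) (sumℚ-nonneg xs f f≥0))

  sumℚ-squares≡0 : (xs : List A) (f : A → ℚ) → sumℚ xs (λ x → f x * f x) ≡ 0ℚ → ∀ x → x ∈ xs → f x ≡ 0ℚ
  sumℚ-squares≡0 (y ∷ ys) f eq x x∈xs
    with nonneg+nonneg≡0 (square-nonneg (f y)) (sumℚ-nonneg ys _ (λ z → square-nonneg (f z))) eq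
  ... | fy²≡0 , rest≡0 with x∈xs
  ...   | here refl  = square≡0 (f y) fy²≡0
  ...   | there x∈ys = sumℚ-squares≡0 ys f rest≡0 x x∈ys

sumℚ-map : {A B : Set} (g : B → A) (xs : List B) (f : A → ℚ) → sumℚ (map g xs) f ≡ sumℚ xs (λ x → f (g x))
sumℚ-map g []       f = refl
sumℚ-map g (x ∷ xs) f = cong (f (g x) +_) (sumℚ-map g xs f)

sumℚ-cartesian : {A B : Set} (xs : List A) (ys : List B) (h : A × B → ℚ) →
                 sumℚ (cartesianProductWith _,_ xs ys) h ≡ sumℚ xs (λ a → sumℚ ys (λ b → h (a , b)))
sumℚ-cartesian []       ys h = refl
sumℚ-cartesian (x ∷ xs) ys h =
  trans (sumℚ-++ (map (x ,_) ys) _ h) (cong₂ _+_ (sumℚ-map (x ,_) ys h) (sumℚ-cartesian xs ys h))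

sumℚ-swap : {A B : Set} (xs : List A) (ys : List B) (h : A → B → ℚ) →
            sumℚ xs (λ a → sumℚ ys (h a)) ≡ sumℚ ys (λ b → sumℚ xs (λ a → h a b))
sumℚ-swap []       ys h = sym (sumℚ-zero ys (λ _ → refl))
sumℚ-swap (x ∷ xs) ys h = trans (cong (sumℚ ys (h x) +_) (sumℚ-swap xs ys h)) (sym (sumℚ-+ ys (h x) _))

sumℚ-concatMap : {A B : Set} (g : A → List B) (xs : List A) (f : B → ℚ) →
                 sumℚ (concatMap g xs) f ≡ sumℚ xs (λ a → sumℚ (g a) f)
sumℚ-concatMap g []       f = refl
sumℚ-concatMap g (x ∷ xs) f = trans (sumℚ-++ (g x) _ f) (cong (sumℚ (g x) f +_) (sumℚ-concatMap g xs f))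

sumℚ-cartesian-* : {A B : Set} (xs : List A) (ys : List B) (f : A → ℚ) (g : B → ℚ) →
                   sumℚ (cartesianProductWith _,_ xs ys) (λ p → f (proj₁ p) * g (proj₂ p)) ≡ sumℚ xs f * sumℚ ys g
sumℚ-cartesian-* xs ys f g = begin
  sumℚ (cartesianProductWith _,_ xs ys) (λ p → f (proj₁ p) * g (proj₂ p)) ≡⟨ sumℚ-cartesian xs ys _ ⟩
  sumℚ xs (λ a → sumℚ ys (λ b → f a * g b))                               ≡⟨ sumℚ-cong xs (λ a → sumℚ-*ˡ ys (f a) g) ⟩
  sumℚ xs (λ a → f a * sumℚ ys g)                                         ≡⟨ sumℚ-*ʳ xs (sumℚ ys g) f ⟩
  sumℚ xs f * sumℚ ys g                                                   ∎
  where open ≡-Reasoning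

sumℚ-upTo-suc : ∀ n (h : ℕ → ℚ) → sumℚ (upTo (suc n)) h ≡ h 0 + sumℚ (upTo n) (λ i → h (suc i))
sumℚ-upTo-suc n h = cong (h 0 +_) (trans (cong (λ xs → sumℚ xs h) (sym (LP.map-upTo suc n))) (sumℚ-map suc (upTo n) h))

sumℚ-upTo-∷ʳ : ∀ n (h : ℕ → ℚ) → sumℚ (upTo (suc n)) h ≡ sumℚ (upTo n) h + h n
sumℚ-upTo-∷ʳ n h = begin
  sumℚ (upTo (suc n)) h             ≡⟨ cong (λ xs → sumℚ xs h) (sym (LP.upTo-∷ʳ n)) ⟩
  sumℚ (upTo n L.∷ʳ n) h            ≡⟨ sumℚ-++ (upTo n) (n ∷ []) h ⟩
  sumℚ (upTo n) h + (h n + 0ℚ)      ≡⟨ cong (sumℚ (upTo n) h +_) (+-identityʳ (h n)) ⟩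
  sumℚ (upTo n) h + h n             ∎
  where open ≡-Reasoning

sumℚ-allFin-suc : ∀ n (h : Fin (suc n) → ℚ) → sumℚ (allFin (suc n)) h ≡ h F.zero + sumℚ (allFin n) (λ a → h (F.suc a))
sumℚ-allFin-suc n h =
  cong (h F.zero +_) (trans (cong (λ xs → sumℚ xs h) (sym (LP.map-tabulate (λ a → a) F.suc))) (sumℚ-map F.suc (allFin n) h))

sumℚ-allFin : ∀ n (h : ℕ → ℚ) → sumℚ (allFin n) (λ a → h (toℕ a)) ≡ sumℚ (upTo n) h
sumℚ-allFin zero    h = refl
sumℚ-allFin (suc n) h = begin
  sumℚ (allFin (suc n)) (λ a → h (toℕ a))          ≡⟨ sumℚ-allFin-suc n (λ a → h (toℕ a)) ⟩
  h 0 + sumℚ (allFin n) (λ a → h (suc (toℕ a)))   ≡⟨ cong (h 0 +_) (sumℚ-allFin n (λ i → h (suc i))) ⟩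
  h 0 + sumℚ (upTo n) (λ i → h (suc i))           ≡⟨ sym (sumℚ-upTo-suc n h) ⟩
  sumℚ (upTo (suc n)) h                            ∎
  where open ≡-Reasoning

≟-suc : ∀ {n} (a s : Fin n) → ⌊ F.suc a FP.≟ F.suc s ⌋ ≡ ⌊ a FP.≟ s ⌋
≟-suc a s with a FP.≟ s
... | yes _ = refl
... | no _  = refl

sumℚ-allFin-δ : ∀ n (s : Fin n) (G : Fin n → ℚ) → sumℚ (allFin n) (λ a → χ ⌊ a FP.≟ s ⌋ * G a) ≡ G s
sumℚ-allFin-δ (suc n) F.zero G = begin
  sumℚ (allFin (suc n)) (λ a → χ ⌊ a FP.≟ F.zero ⌋ * G a)  ≡⟨ sumℚ-allFin-suc n (λ a → χ ⌊ a FP.≟ F.zero ⌋ * G a) ⟩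
  1ℚ * G F.zero + sumℚ (allFin n) (λ a → 0ℚ * G (F.suc a))  ≡⟨ cong₂ _+_ (*-identityˡ (G F.zero)) (sumℚ-zero (allFin n) (λ a → *-zeroˡ (G (F.suc a)))) ⟩
  G F.zero + 0ℚ                                              ≡⟨ +-identityʳ _ ⟩
  G F.zero                                                   ∎
  where open ≡-Reasoning
sumℚ-allFin-δ (suc n) (F.suc s) G = begin
  sumℚ (allFin (suc n)) (λ a → χ ⌊ a FP.≟ F.suc s ⌋ * G a)                  ≡⟨ sumℚ-allFin-suc n (λ a → χ ⌊ a FP.≟ F.suc s ⌋ * G a) ⟩
  0ℚ * G F.zero + sumℚ (allFin n) (λ a → χ ⌊ F.suc a FP.≟ F.suc s ⌋ * G (F.suc a))
    ≡⟨ cong₂ _+_ (*-zeroˡ (G F.zero)) (sumℚ-cong (allFin n) (λ a → cong (λ d → χ d * G (F.suc a)) (≟-suc a s))) ⟩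
  0ℚ + sumℚ (allFin n) (λ a → χ ⌊ a FP.≟ s ⌋ * G (F.suc a))                ≡⟨ cong (0ℚ +_) (sumℚ-allFin-δ n s (λ a → G (F.suc a))) ⟩
  0ℚ + G (F.suc s)                                                           ≡⟨ +-identityˡ _ ⟩
  G (F.suc s)                                                                ∎
  where open ≡-Reasoning

sumℚ-upTo-δ : ∀ n t (G : ℕ → ℚ) → t < n → sumℚ (upTo n) (λ i → χ (i ≡ᵇ t) * G i) ≡ G t
sumℚ-upTo-δ (suc n) zero G _ = begin
  sumℚ (upTo (suc n)) (λ i → χ (i ≡ᵇ 0) * G i)          ≡⟨ sumℚ-upTo-suc n (λ i → χ (i ≡ᵇ 0) * G i) ⟩
  1ℚ * G 0 + sumℚ (upTo n) (λ i → 0ℚ * G (suc i))       ≡⟨ cong₂ _+_ (*-identityˡ (G 0)) (sumℚ-zero (upTo n) (λ i → *-zeroˡ (G (suc i)))) ⟩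
  G 0 + 0ℚ                                               ≡⟨ +-identityʳ _ ⟩
  G 0                                                    ∎
  where open ≡-Reasoning
sumℚ-upTo-δ (suc n) (suc t) G (s≤s t<n) = begin
  sumℚ (upTo (suc n)) (λ i → χ (i ≡ᵇ suc t) * G i)            ≡⟨ sumℚ-upTo-suc n (λ i → χ (i ≡ᵇ suc t) * G i) ⟩
  0ℚ * G 0 + sumℚ (upTo n) (λ i → χ (i ≡ᵇ t) * G (suc i))     ≡⟨ cong₂ _+_ (*-zeroˡ (G 0)) (sumℚ-upTo-δ n t (λ i → G (suc i)) t<n) ⟩
  0ℚ + G (suc t)                                               ≡⟨ +-identityˡ _ ⟩
  G (suc t)                                                    ∎
  where open ≡-Reasoning

sumℚ-upTo-ones : ∀ m (F : ℕ → ℚ) → (∀ i → i < m → F i ≡ 1ℚ) → sumℚ (upTo m) F ≡ ℕtoℚ m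
sumℚ-upTo-ones zero    F F≡1 = refl
sumℚ-upTo-ones (suc m) F F≡1 = begin
  sumℚ (upTo (suc m)) F      ≡⟨ sumℚ-upTo-∷ʳ m F ⟩
  sumℚ (upTo m) F + F m      ≡⟨ cong₂ _+_ (sumℚ-upTo-ones m F (λ i i<m → F≡1 i (ℕP.m<n⇒m<1+n i<m))) (F≡1 m (ℕP.n<1+n m)) ⟩
  ℕtoℚ m + 1ℚ                ≡⟨ +-comm (ℕtoℚ m) 1ℚ ⟩
  1ℚ + ℕtoℚ m                ≡⟨ sym (ℕtoℚ-suc m) ⟩
  ℕtoℚ (suc m)               ∎
  where open ≡-Reasoning

sumℚ-upTo-step : ∀ m j (F : ℕ → ℚ) → (∀ i → i < j → F i ≡ 1ℚ) → (∀ i → j < i → F i ≡ 0ℚ) → j < m →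
                 sumℚ (upTo m) F ≡ ℕtoℚ j + F j
sumℚ-upTo-step (suc m) j F F≡1 F≡0 (s≤s j≤m) with ℕP.m≤n⇒m<n∨m≡n j≤m
... | inj₂ refl = trans (sumℚ-upTo-∷ʳ j F) (cong (_+ F j) (sumℚ-upTo-ones j F F≡1))
... | inj₁ j<m  = begin
  sumℚ (upTo (suc m)) F      ≡⟨ sumℚ-upTo-∷ʳ m F ⟩
  sumℚ (upTo m) F + F m      ≡⟨ cong₂ _+_ (sumℚ-upTo-step m j F F≡1 F≡0 j<m) (F≡0 m j<m) ⟩
  ℕtoℚ j + F j + 0ℚ          ≡⟨ +-identityʳ _ ⟩
  ℕtoℚ j + F j               ∎
  where open ≡-Reasoning

sumℚ-upTo-last : ∀ m (F : ℕ → ℚ) → (∀ i → i < m → F i ≡ 0ℚ) → sumℚ (upTo (suc m)) F ≡ F m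
sumℚ-upTo-last m F F≡0 = begin
  sumℚ (upTo (suc m)) F      ≡⟨ sumℚ-upTo-∷ʳ m F ⟩
  sumℚ (upTo m) F + F m      ≡⟨ cong (_+ F m) (sumℚ-zero-∈ (upTo m) (λ i i∈ → F≡0 i (∈-upTo⁻ i∈))) ⟩
  0ℚ + F m                   ≡⟨ +-identityˡ (F m) ⟩
  F m                        ∎
  where open ≡-Reasoning

T→≡true : ∀ {b} → T b → b ≡ true
T→≡true {true} _ = refl

≡ᵇ-refl : ∀ i → (i ≡ᵇ i) ≡ true
≡ᵇ-refl i = T→≡true (ℕP.≡⇒≡ᵇ i i refl)

≢⇒≡ᵇ-false : ∀ {i j} → i ≢ j → (i ≡ᵇ j) ≡ false
≢⇒≡ᵇ-false {i} {j} i≢j with i ≡ᵇ j in eq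
... | false = refl
... | true  = ⊥-elim (i≢j (ℕP.≡ᵇ⇒≡ i j (subst T (sym eq) tt)))

<⇒<ᵇ-true : ∀ {i j} → i < j → (i <ᵇ j) ≡ true
<⇒<ᵇ-true i<j = T→≡true (ℕP.<⇒<ᵇ i<j)

≮⇒<ᵇ-false : ∀ {i j} → ¬ (i < j) → (i <ᵇ j) ≡ false
≮⇒<ᵇ-false {i} {j} i≮j with i <ᵇ j in eq
... | false = refl
... | true  = ⊥-elim (i≮j (ℕP.<ᵇ⇒< i j (subst T (sym eq) tt)))

φ : ℕ → ℕ → ℚ
φ i j = if i ≡ᵇ j then - ℕtoℚ j else (if i <ᵇ j then 1ℚ else 0ℚ)

φ-diag : ∀ j → φ j j ≡ - ℕtoℚ j
φ-diag j rewrite ≡ᵇ-refl j = refl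

φ-≢ : ∀ {i j} → i ≢ j → φ i j ≡ (if i <ᵇ j then 1ℚ else 0ℚ)
φ-≢ i≢j rewrite ≢⇒≡ᵇ-false i≢j = refl

φ-< : ∀ {i j} → i < j → φ i j ≡ 1ℚ
φ-< i<j rewrite ≢⇒≡ᵇ-false (ℕP.<⇒≢ i<j) | <⇒<ᵇ-true i<j = refl

φ-> : ∀ {i j} → j < i → φ i j ≡ 0ℚ
φ-> j<i rewrite ≢⇒≡ᵇ-false (ℕP.>⇒≢ j<i) | ≮⇒<ᵇ-false (ℕP.<⇒≯ j<i) = refl

ν-just : ∀ {b} (a : Fin b) (y : Δsym b) → ν (just a) y ≡ φ (toℕ a) (rank y)
ν-just a nothing  = trans (cong (λ t → if t then 1ℚ else 0ℚ) (<⇒<ᵇ-true (FP.toℕ<n a))) (sym (φ-< (FP.toℕ<n a)))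
ν-just a (just c) with a FP.≟ c
... | yes refl = sym (φ-diag (toℕ a))
... | no a≢c   = sym (φ-≢ (λ e → a≢c (FP.toℕ-injective e)))

sumℚ-ν-just : ∀ {b} (F : ℚ → ℚ → ℚ) (y y' : Δsym b) →
              sumℚ (allFin b) (λ a → F (ν (just a) y) (ν (just a) y')) ≡ sumℚ (upTo b) (λ i → F (φ i (rank y)) (φ i (rank y')))
sumℚ-ν-just {b} F y y' =
  trans (sumℚ-cong (allFin b) (λ a → cong₂ F (ν-just a y) (ν-just a y'))) (sumℚ-allFin b (λ i → F (φ i (rank y)) (φ i (rank y'))))

ν-column-sum : ∀ {b} (c : Fin b) → sumℚ (allFin b) (λ a → ν (just a) (just c)) ≡ 0ℚ
ν-column-sum {b} c = begin
  sumℚ (allFin b) (λ a → ν (just a) (just c))   ≡⟨ sumℚ-cong (allFin b) (λ a → ν-just a (just c)) ⟩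
  sumℚ (allFin b) (λ a → φ (toℕ a) j)          ≡⟨ sumℚ-allFin b (λ i → φ i j) ⟩
  sumℚ (upTo b) (λ i → φ i j)                  ≡⟨ sumℚ-upTo-step b j (λ i → φ i j) (λ i → φ-<) (λ i → φ->) (FP.toℕ<n c) ⟩
  ℕtoℚ j + φ j j                               ≡⟨ cong (ℕtoℚ j +_) (φ-diag j) ⟩
  ℕtoℚ j + - ℕtoℚ j                            ≡⟨ +-inverseʳ (ℕtoℚ j) ⟩
  0ℚ                                           ∎
  where
  open ≡-Reasoning
  j = toℕ c

φφ-< : ∀ b {j j'} → j < j' → j < b → sumℚ (upTo b) (λ i → φ i j * φ i j') ≡ 0ℚ
φφ-< b {j} {j'} j<j' j<b = begin
  sumℚ (upTo b) (λ i → φ i j * φ i j')     ≡⟨ sumℚ-upTo-step b j _ below above j<b ⟩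
  ℕtoℚ j + φ j j * φ j j'                  ≡⟨ cong₂ (λ p q → ℕtoℚ j + p * q) (φ-diag j) (φ-< j<j') ⟩
  ℕtoℚ j + - ℕtoℚ j * 1ℚ                   ≡⟨ cancel (ℕtoℚ j) ⟩
  0ℚ                                       ∎
  where
  open ≡-Reasoning
  below : ∀ i → i < j → φ i j * φ i j' ≡ 1ℚ
  below i i<j = trans (cong₂ _*_ (φ-< i<j) (φ-< (ℕP.<-trans i<j j<j'))) (*-identityˡ 1ℚ)
  above : ∀ i → j < i → φ i j * φ i j' ≡ 0ℚ
  above i j<i = trans (cong (_* φ i j') (φ-> j<i)) (*-zeroˡ (φ i j'))
  cancel : ∀ x → x + - x * 1ℚ ≡ 0ℚ
  cancel = solve-∀ ℚ-ring

φφ-diag : ∀ b {j} → j < b → sumℚ (upTo b) (λ i → φ i j * φ i j) ≡ ℕtoℚ j * ℕtoℚ (suc j)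
φφ-diag b {j} j<b = begin
  sumℚ (upTo b) (λ i → φ i j * φ i j)      ≡⟨ sumℚ-upTo-step b j _ below above j<b ⟩
  ℕtoℚ j + φ j j * φ j j                   ≡⟨ cong (λ p → ℕtoℚ j + p * p) (φ-diag j) ⟩
  ℕtoℚ j + - ℕtoℚ j * - ℕtoℚ j             ≡⟨ factor (ℕtoℚ j) ⟩
  ℕtoℚ j * (1ℚ + ℕtoℚ j)                   ≡⟨ cong (ℕtoℚ j *_) (sym (ℕtoℚ-suc j)) ⟩
  ℕtoℚ j * ℕtoℚ (suc j)                    ∎
  where
  open ≡-Reasoning
  below : ∀ i → i < j → φ i j * φ i j ≡ 1ℚ
  below i i<j = trans (cong₂ _*_ (φ-< i<j) (φ-< i<j)) (*-identityˡ 1ℚ)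
  above : ∀ i → j < i → φ i j * φ i j ≡ 0ℚ
  above i j<i = trans (cong (_* φ i j) (φ-> j<i)) (*-zeroˡ (φ i j))
  factor : ∀ x → x + - x * - x ≡ x * (1ℚ + x)
  factor = solve-∀ ℚ-ring

φφ-top : ∀ b → sumℚ (upTo b) (λ i → φ i b * φ i b) ≡ ℕtoℚ b
φφ-top b = sumℚ-upTo-ones b _ (λ i i<b → trans (cong₂ _*_ (φ-< i<b) (φ-< i<b)) (*-identityˡ 1ℚ))

sameSym : ∀ {b} → Δsym b → Δsym b → Bool
sameSym nothing  nothing   = true
sameSym nothing  (just _)  = false
sameSym (just _) nothing   = false
sameSym (just a) (just c)  = ⌊ a FP.≟ c ⌋

normSq₁ : ∀ b → Δsym b → ℚ
normSq₁ b nothing  = ℕtoℚ b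
normSq₁ b (just c) = ℕtoℚ (toℕ c) * ℕtoℚ (suc (toℕ c))

ν-orthogonal : ∀ {b} (y y' : Δsym b) →
               sumℚ (allFin b) (λ a → ν (just a) y * ν (just a) y') ≡ χ (sameSym y y') * normSq₁ b y'
ν-orthogonal {b} y y' = trans (sumℚ-ν-just _*_ y y') (φφ-sum y y')
  where
  swap : ∀ j j' → sumℚ (upTo b) (λ i → φ i j * φ i j') ≡ sumℚ (upTo b) (λ i → φ i j' * φ i j)
  swap j j' = sumℚ-cong (upTo b) (λ i → *-comm (φ i j) (φ i j'))
  φφ-sum : (y y' : Δsym b) → sumℚ (upTo b) (λ i → φ i (rank y) * φ i (rank y')) ≡ χ (sameSym y y') * normSq₁ b y'
  φφ-sum nothing  nothing   = trans (φφ-top b) (sym (*-identityˡ _))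
  φφ-sum nothing  (just c)  =
    trans (swap b (toℕ c)) (trans (φφ-< b (FP.toℕ<n c) (FP.toℕ<n c)) (sym (*-zeroˡ (normSq₁ b (just c)))))
  φφ-sum (just c) nothing   = trans (φφ-< b (FP.toℕ<n c) (FP.toℕ<n c)) (sym (*-zeroˡ (ℕtoℚ b)))
  φφ-sum (just c) (just c') with c FP.≟ c'
  ... | yes refl = trans (φφ-diag b (FP.toℕ<n c)) (sym (*-identityˡ _))
  ... | no c≢c' with ℕP.<-cmp (toℕ c) (toℕ c')
  ...   | tri< c<c' _ _ = trans (φφ-< b c<c' (FP.toℕ<n c)) (sym (*-zeroˡ (normSq₁ b (just c'))))
  ...   | tri≈ _ c≡c' _ = ⊥-elim (c≢c' (FP.toℕ-injective c≡c'))
  ...   | tri> _ _ c'<c = trans (swap (toℕ c) (toℕ c')) (trans (φφ-< b c'<c (FP.toℕ<n c')) (sym (*-zeroˡ (normSq₁ b (just c')))))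

-- 1/(c(c+1)) = 1/c - 1/(c+1) for c ≥ 1; the value at c = 0 is irrelevant since ν (just a) (just 0) = 0
digitWeight : ℕ → ℚ
digitWeight c = recip c + - recip (suc c)

weight₁ : ∀ b → Δsym b → ℚ
weight₁ b nothing  = recip b
weight₁ b (just c) = digitWeight (toℕ c)

ℕtoℚ*recip-suc : ∀ n → ℕtoℚ n * recip (suc n) ≡ 1ℚ + - recip (suc n)
ℕtoℚ*recip-suc n = begin
  ℕtoℚ n * r                         ≡⟨ shift (ℕtoℚ n) r ⟩
  (1ℚ + ℕtoℚ n) * r + - r            ≡⟨ cong (λ q → q * r + - r) (sym (ℕtoℚ-suc n)) ⟩
  ℕtoℚ (suc n) * r + - r             ≡⟨ cong (_+ - r) (ℕtoℚ*recip n) ⟩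
  1ℚ + - r                           ∎
  where
  open ≡-Reasoning
  r = recip (suc n)
  shift : ∀ q r → q * r ≡ (1ℚ + q) * r + - r
  shift = solve-∀ ℚ-ring

ℕtoℚ*digitWeight : ∀ p → ℕtoℚ (suc p) * digitWeight (suc p) ≡ recip (suc (suc p))
ℕtoℚ*digitWeight p = begin
  q * (recip (suc p) + - r)          ≡⟨ *-distribˡ-+ q (recip (suc p)) (- r) ⟩
  q * recip (suc p) + q * - r        ≡⟨ cong₂ _+_ (ℕtoℚ*recip p) (sym (neg-distribʳ-* q r)) ⟩
  1ℚ + - (q * r)                     ≡⟨ cong (λ s → 1ℚ + - s) (ℕtoℚ*recip-suc (suc p)) ⟩
  1ℚ + - (1ℚ + - r)                  ≡⟨ simplify r ⟩
  r                                  ∎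
  where
  open ≡-Reasoning
  q = ℕtoℚ (suc p)
  r = recip (suc (suc p))
  simplify : ∀ r → 1ℚ + - (1ℚ + - r) ≡ r
  simplify = solve-∀ ℚ-ring

ℕtoℚ²*digitWeight : ∀ m → ℕtoℚ m * ℕtoℚ m * digitWeight m ≡ 1ℚ + - recip (suc m)
ℕtoℚ²*digitWeight zero    = trans (*-zeroˡ (digitWeight 0)) (trans (sym (*-zeroˡ (recip 1))) (ℕtoℚ*recip-suc 0))
ℕtoℚ²*digitWeight (suc p) = begin
  q * q * digitWeight (suc p)        ≡⟨ *-assoc q q _ ⟩
  q * (q * digitWeight (suc p))      ≡⟨ cong (q *_) (ℕtoℚ*digitWeight p) ⟩
  q * recip (suc (suc p))            ≡⟨ ℕtoℚ*recip-suc (suc p) ⟩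
  1ℚ + - recip (suc (suc p))         ∎
  where
  open ≡-Reasoning
  q = ℕtoℚ (suc p)

edge-term : ∀ {j m} → j < m → - ℕtoℚ m * 1ℚ * digitWeight m ≡ 0ℚ + - recip (suc m)
edge-term {m = suc p} _ = begin
  - q * 1ℚ * digitWeight (suc p)     ≡⟨ regroup q (digitWeight (suc p)) ⟩
  0ℚ + - (q * digitWeight (suc p))   ≡⟨ cong (λ t → 0ℚ + - t) (ℕtoℚ*digitWeight p) ⟩
  0ℚ + - recip (suc (suc p))         ∎
  where
  open ≡-Reasoning
  q = ℕtoℚ (suc p)
  regroup : ∀ q w → - q * 1ℚ * w ≡ 0ℚ + - (q * w)
  regroup = solve-∀ ℚ-ring

*-zeroˡ₃ : ∀ {p} q w → p ≡ 0ℚ → p * q * w ≡ 0ℚ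
*-zeroˡ₃ q w refl = trans (cong (_* w) (*-zeroˡ q)) (*-zeroˡ w)

*-zeroᵐ₃ : ∀ p {q} w → q ≡ 0ℚ → p * q * w ≡ 0ℚ
*-zeroᵐ₃ p w refl = trans (cong (_* w) (*-zeroʳ p)) (*-zeroˡ w)

telescoping : ∀ m i i' → i < m → i' < m →
              sumℚ (upTo m) (λ y → φ i y * φ i' y * digitWeight y) ≡ χ (i ≡ᵇ i') + - recip m
telescoping (suc m) i i' (s≤s i≤m) (s≤s i'≤m) with ℕP.m≤n⇒m<n∨m≡n i≤m | ℕP.m≤n⇒m<n∨m≡n i'≤m
... | inj₁ i<m | inj₁ i'<m = begin
  sumℚ (upTo (suc m)) F                                     ≡⟨ sumℚ-upTo-∷ʳ m F ⟩
  sumℚ (upTo m) F + F m                                     ≡⟨ cong₂ _+_ (telescoping m i i' i<m i'<m) (cong₂ (λ p q → p * q * digitWeight m) (φ-< i<m) (φ-< i'<m)) ⟩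
  χ (i ≡ᵇ i') + - recip m + 1ℚ * 1ℚ * digitWeight m         ≡⟨ telescope (χ (i ≡ᵇ i')) (recip m) (recip (suc m)) ⟩
  χ (i ≡ᵇ i') + - recip (suc m)                             ∎
  where
  open ≡-Reasoning
  F = λ y → φ i y * φ i' y * digitWeight y
  telescope : ∀ d r r' → d + - r + 1ℚ * 1ℚ * (r + - r') ≡ d + - r'
  telescope = solve-∀ ℚ-ring
... | inj₂ refl | inj₂ refl = begin
  sumℚ (upTo (suc i)) (λ y → φ i y * φ i y * digitWeight y)   ≡⟨ sumℚ-upTo-last i _ (λ y y<i → *-zeroˡ₃ _ (digitWeight y) (φ-> y<i)) ⟩
  φ i i * φ i i * digitWeight i                              ≡⟨ cong (λ p → p * p * digitWeight i) (φ-diag i) ⟩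
  - ℕtoℚ i * - ℕtoℚ i * digitWeight i                        ≡⟨ cong (_* digitWeight i) (neg*neg (ℕtoℚ i)) ⟩
  ℕtoℚ i * ℕtoℚ i * digitWeight i                            ≡⟨ ℕtoℚ²*digitWeight i ⟩
  1ℚ + - recip (suc i)                                       ≡⟨ cong (λ b → χ b + - recip (suc i)) (sym (≡ᵇ-refl i)) ⟩
  χ (i ≡ᵇ i) + - recip (suc i)                               ∎
  where
  open ≡-Reasoning
  neg*neg : ∀ x → - x * - x ≡ x * x
  neg*neg = solve-∀ ℚ-ring
... | inj₂ refl | inj₁ i'<i = begin
  sumℚ (upTo (suc i)) (λ y → φ i y * φ i' y * digitWeight y) ≡⟨ sumℚ-upTo-last i _ (λ y y<i → *-zeroˡ₃ _ (digitWeight y) (φ-> y<i)) ⟩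
  φ i i * φ i' i * digitWeight i                             ≡⟨ cong₂ (λ p q → p * q * digitWeight i) (φ-diag i) (φ-< i'<i) ⟩
  - ℕtoℚ i * 1ℚ * digitWeight i                              ≡⟨ edge-term i'<i ⟩
  0ℚ + - recip (suc i)                                       ≡⟨ cong (λ b → χ b + - recip (suc i)) (sym (≢⇒≡ᵇ-false (ℕP.>⇒≢ i'<i))) ⟩
  χ (i ≡ᵇ i') + - recip (suc i)                              ∎
  where open ≡-Reasoning
... | inj₁ i<i' | inj₂ refl = begin
  sumℚ (upTo (suc i')) (λ y → φ i y * φ i' y * digitWeight y) ≡⟨ sumℚ-upTo-last i' _ (λ y y<i' → *-zeroᵐ₃ (φ i y) (digitWeight y) (φ-> y<i')) ⟩
  φ i i' * φ i' i' * digitWeight i'                          ≡⟨ cong₂ (λ p q → p * q * digitWeight i') (φ-< i<i') (φ-diag i') ⟩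
  1ℚ * - ℕtoℚ i' * digitWeight i'                            ≡⟨ cong (_* digitWeight i') (*-comm 1ℚ (- ℕtoℚ i')) ⟩
  - ℕtoℚ i' * 1ℚ * digitWeight i'                            ≡⟨ edge-term i<i' ⟩
  0ℚ + - recip (suc i')                                      ≡⟨ cong (λ b → χ b + - recip (suc i')) (sym (≢⇒≡ᵇ-false (ℕP.<⇒≢ i<i'))) ⟩
  χ (i ≡ᵇ i') + - recip (suc i')                             ∎
  where open ≡-Reasoning

⌊≟⌋≡≡ᵇ : ∀ {b} (a a' : Fin b) → ⌊ a FP.≟ a' ⌋ ≡ (toℕ a ≡ᵇ toℕ a')
⌊≟⌋≡≡ᵇ a a' with a FP.≟ a'
... | yes refl = sym (≡ᵇ-refl (toℕ a))
... | no a≢a'  = sym (≢⇒≡ᵇ-false (λ e → a≢a' (FP.toℕ-injective e)))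

ν-gap : ∀ {b} (c : Fin b) → ν (just c) nothing ≡ 1ℚ
ν-gap c = trans (ν-just c nothing) (φ-< (FP.toℕ<n c))

ν-complete : ∀ {b} (a a' : Fin b) →
             sumℚ (allΔsym b) (λ y → ν (just a) y * ν (just a') y * weight₁ b y) ≡ χ ⌊ a FP.≟ a' ⌋
ν-complete {b} a a' = begin
  ν (just a) nothing * ν (just a') nothing * recip b + sumℚ (map just (allFin b)) F
    ≡⟨ cong₂ _+_ (cong₂ (λ p q → p * q * recip b) (ν-gap a) (ν-gap a')) (sumℚ-map just (allFin b) F) ⟩
  1ℚ * 1ℚ * recip b + sumℚ (allFin b) (λ c → F (just c))
    ≡⟨ cong (1ℚ * 1ℚ * recip b +_) (sumℚ-cong (allFin b) (λ c → cong₂ (λ p q → p * q * digitWeight (toℕ c)) (ν-just a (just c)) (ν-just a' (just c)))) ⟩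
  1ℚ * 1ℚ * recip b + sumℚ (allFin b) (λ c → φ i (toℕ c) * φ i' (toℕ c) * digitWeight (toℕ c))
    ≡⟨ cong (1ℚ * 1ℚ * recip b +_) (sumℚ-allFin b (λ y → φ i y * φ i' y * digitWeight y)) ⟩
  1ℚ * 1ℚ * recip b + sumℚ (upTo b) (λ y → φ i y * φ i' y * digitWeight y)
    ≡⟨ cong (1ℚ * 1ℚ * recip b +_) (telescoping b i i' (FP.toℕ<n a) (FP.toℕ<n a')) ⟩
  1ℚ * 1ℚ * recip b + (χ (i ≡ᵇ i') + - recip b)
    ≡⟨ cancel (recip b) (χ (i ≡ᵇ i')) ⟩
  χ (i ≡ᵇ i')
    ≡⟨ cong χ (sym (⌊≟⌋≡≡ᵇ a a')) ⟩
  χ ⌊ a FP.≟ a' ⌋ ∎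
  where
  open ≡-Reasoning
  i = toℕ a
  i' = toℕ a'
  F = λ y → ν (just a) y * ν (just a') y * weight₁ b y
  cancel : ∀ r d → 1ℚ * 1ℚ * r + (d + - r) ≡ d
  cancel = solve-∀ ℚ-ring

ζ : ∀ {ℓ} {B : Vec ℕ ℓ} → ΔW B → VecΣ B
ζ v u = νB (embed u) v

-- (A x)_d for d ∈ V_{ℓ,k;B}, extended to patterns d with any number of gaps
patternSum : ∀ {ℓ} (B : Vec ℕ ℓ) → VecΣ B → ΔW B → ℚ
patternSum B x d = sumℚ (allΣ B) (λ u → χ (matches u d) * x u)

sameWord : ∀ {ℓ} {B : Vec ℕ ℓ} → ΔW B → ΔW B → Bool
sameWord {B = []}    tt      tt        = true
sameWord {B = b ∷ B} (y , v) (y' , v') = sameSym y y' ∧ sameWord v v'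

normSq : ∀ {ℓ} {B : Vec ℕ ℓ} → ΔW B → ℚ
normSq {B = []}    tt      = 1ℚ
normSq {B = b ∷ B} (y , v) = normSq₁ b y * normSq v

weight : ∀ {ℓ} {B : Vec ℕ ℓ} → ΔW B → ℚ
weight {B = []}    tt      = 1ℚ
weight {B = b ∷ B} (y , v) = weight₁ b y * weight v

interchange-* : ∀ p q r s → (p * q) * (r * s) ≡ (p * r) * (q * s)
interchange-* = solve-∀ ℚ-ring

ζ-orthogonal : ∀ {ℓ} (B : Vec ℕ ℓ) (v w : ΔW B) →
               sumℚ (allΣ B) (λ u → ζ v u * ζ w u) ≡ χ (sameWord v w) * normSq w
ζ-orthogonal []      tt      tt       = +-identityʳ _
ζ-orthogonal (b ∷ B) (y , v) (y' , w) = begin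
  sumℚ (allΣ (b ∷ B)) (λ u → ζ (y , v) u * ζ (y' , w) u)
    ≡⟨ sumℚ-cong (allΣ (b ∷ B)) (λ { (a , u) → interchange-* (ν (just a) y) (ζ v u) (ν (just a) y') (ζ w u) }) ⟩
  sumℚ (allΣ (b ∷ B)) (λ p → (ν (just (proj₁ p)) y * ν (just (proj₁ p)) y') * (ζ v (proj₂ p) * ζ w (proj₂ p)))
    ≡⟨ sumℚ-cartesian-* (allFin b) (allΣ B) (λ a → ν (just a) y * ν (just a) y') (λ u → ζ v u * ζ w u) ⟩
  sumℚ (allFin b) (λ a → ν (just a) y * ν (just a) y') * sumℚ (allΣ B) (λ u → ζ v u * ζ w u)
    ≡⟨ cong₂ _*_ (ν-orthogonal y y') (ζ-orthogonal B v w) ⟩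
  (χ (sameSym y y') * normSq₁ b y') * (χ (sameWord v w) * normSq w)
    ≡⟨ interchange-* (χ (sameSym y y')) (normSq₁ b y') (χ (sameWord v w)) (normSq w) ⟩
  (χ (sameSym y y') * χ (sameWord v w)) * (normSq₁ b y' * normSq w)
    ≡⟨ cong (_* (normSq₁ b y' * normSq w)) (sym (χ-∧ (sameSym y y') (sameWord v w))) ⟩
  χ (sameSym y y' ∧ sameWord v w) * (normSq₁ b y' * normSq w) ∎
  where open ≡-Reasoning

ζ-complete : ∀ {ℓ} (B : Vec ℕ ℓ) (w u : ΣW B) →
             sumℚ (allΔ B) (λ v → ζ v w * ζ v u * weight v) ≡ χ (matches w (embed u))
ζ-complete []      tt      tt      = trans (+-identityʳ _) (*-identityˡ _)
ζ-complete (b ∷ B) (a , w) (a' , u) = begin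
  sumℚ (allΔ (b ∷ B)) (λ v → ζ v (a , w) * ζ v (a' , u) * weight v)
    ≡⟨ sumℚ-cong (allΔ (b ∷ B)) (λ { (y , v) → regroup (ν (just a) y) (ζ v w) (ν (just a') y) (ζ v u) (weight₁ b y) (weight v) }) ⟩
  sumℚ (allΔ (b ∷ B)) (λ p → (ν (just a) (proj₁ p) * ν (just a') (proj₁ p) * weight₁ b (proj₁ p)) * (ζ (proj₂ p) w * ζ (proj₂ p) u * weight (proj₂ p)))
    ≡⟨ sumℚ-cartesian-* (allΔsym b) (allΔ B) (λ y → ν (just a) y * ν (just a') y * weight₁ b y) (λ v → ζ v w * ζ v u * weight v) ⟩
  sumℚ (allΔsym b) (λ y → ν (just a) y * ν (just a') y * weight₁ b y) * sumℚ (allΔ B) (λ v → ζ v w * ζ v u * weight v)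
    ≡⟨ cong₂ _*_ (ν-complete a a') (ζ-complete B w u) ⟩
  χ ⌊ a FP.≟ a' ⌋ * χ (matches w (embed u))
    ≡⟨ sym (χ-∧ ⌊ a FP.≟ a' ⌋ (matches w (embed u))) ⟩
  χ (⌊ a FP.≟ a' ⌋ ∧ matches w (embed u)) ∎
  where
  open ≡-Reasoning
  regroup : ∀ p P q Q s S → (p * P) * (q * Q) * (s * S) ≡ (p * q * s) * (P * Q * S)
  regroup = solve-∀ ℚ-ring

matches₁ : ∀ {b} → Fin b → Δsym b → Bool
matches₁ a nothing  = true
matches₁ a (just c) = ⌊ a FP.≟ c ⌋

χ-matches-∷ : ∀ {ℓ b} {B : Vec ℕ ℓ} (a : Fin b) (w : ΣW B) (y : Δsym b) (v : ΔW B) →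
              χ (matches {B = b ∷ B} (a , w) (y , v)) ≡ χ (matches₁ a y) * χ (matches w v)
χ-matches-∷ a w nothing  v = χ-∧ true (matches w v)
χ-matches-∷ a w (just c) v = χ-∧ ⌊ a FP.≟ c ⌋ (matches w v)

sumℚ-allΣ-head : ∀ {ℓ b} {B : Vec ℕ ℓ} (a : Fin b) (m : ΣW B → Bool) (x : VecΣ (b ∷ B)) →
                 sumℚ (allΣ (b ∷ B)) (λ p → χ (⌊ proj₁ p FP.≟ a ⌋ ∧ m (proj₂ p)) * x p) ≡ sumℚ (allΣ B) (λ w → χ (m w) * x (a , w))
sumℚ-allΣ-head {b = b} {B} a m x = begin
  sumℚ (allΣ (b ∷ B)) (λ p → χ (⌊ proj₁ p FP.≟ a ⌋ ∧ m (proj₂ p)) * x p)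
    ≡⟨ sumℚ-cartesian (allFin b) (allΣ B) _ ⟩
  sumℚ (allFin b) (λ a' → sumℚ (allΣ B) (λ w → χ (⌊ a' FP.≟ a ⌋ ∧ m w) * x (a' , w)))
    ≡⟨ sumℚ-cong (allFin b) (λ a' → trans (sumℚ-cong (allΣ B) (λ w → split a' w)) (sumℚ-*ˡ (allΣ B) (χ ⌊ a' FP.≟ a ⌋) _)) ⟩
  sumℚ (allFin b) (λ a' → χ ⌊ a' FP.≟ a ⌋ * sumℚ (allΣ B) (λ w → χ (m w) * x (a' , w)))
    ≡⟨ sumℚ-allFin-δ b a (λ a' → sumℚ (allΣ B) (λ w → χ (m w) * x (a' , w))) ⟩
  sumℚ (allΣ B) (λ w → χ (m w) * x (a , w)) ∎
  where
  open ≡-Reasoning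
  split : ∀ a' w → χ (⌊ a' FP.≟ a ⌋ ∧ m w) * x (a' , w) ≡ χ ⌊ a' FP.≟ a ⌋ * (χ (m w) * x (a' , w))
  split a' w = trans (cong (_* x (a' , w)) (χ-∧ ⌊ a' FP.≟ a ⌋ (m w))) (*-assoc (χ ⌊ a' FP.≟ a ⌋) (χ (m w)) (x (a' , w)))

sumℚ-allΣ-δ : ∀ {ℓ} (B : Vec ℕ ℓ) (u : ΣW B) (x : VecΣ B) → sumℚ (allΣ B) (λ w → χ (matches w (embed u)) * x w) ≡ x u
sumℚ-allΣ-δ []      tt      x = trans (+-identityʳ _) (*-identityˡ _)
sumℚ-allΣ-δ (b ∷ B) (a , u) x =
  trans (sumℚ-allΣ-head a (λ w → matches w (embed u)) x) (sumℚ-allΣ-δ B u (λ w → x (a , w)))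

sumℚ-allΔsym-δ : ∀ b (t : Δsym b) (h : Δsym b → ℚ) → sumℚ (allΔsym b) (λ y → χ (sameSym y t) * h y) ≡ h t
sumℚ-allΔsym-δ b nothing h =
  trans (cong₂ _+_ (*-identityˡ (h nothing)) (trans (sumℚ-map just (allFin b) _) (sumℚ-zero (allFin b) (λ a → *-zeroˡ (h (just a))))))
        (+-identityʳ _)
sumℚ-allΔsym-δ b (just c) h =
  trans (cong₂ _+_ (*-zeroˡ (h nothing)) (trans (sumℚ-map just (allFin b) _) (sumℚ-allFin-δ b c (λ a → h (just a)))))
        (+-identityˡ _)

sumℚ-allΔ-δ : ∀ {ℓ} (B : Vec ℕ ℓ) (t : ΔW B) (g : ΔW B → ℚ) → sumℚ (allΔ B) (λ v → χ (sameWord v t) * g v) ≡ g t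
sumℚ-allΔ-δ []       tt       g = trans (+-identityʳ _) (*-identityˡ _)
sumℚ-allΔ-δ (b ∷ B) (y' , t) g = begin
  sumℚ (allΔ (b ∷ B)) (λ v → χ (sameWord v (y' , t)) * g v)
    ≡⟨ sumℚ-cartesian (allΔsym b) (allΔ B) _ ⟩
  sumℚ (allΔsym b) (λ y → sumℚ (allΔ B) (λ v → χ (sameSym y y' ∧ sameWord v t) * g (y , v)))
    ≡⟨ sumℚ-cong (allΔsym b) (λ y → trans (sumℚ-cong (allΔ B) (λ v → split y v)) (sumℚ-*ˡ (allΔ B) (χ (sameSym y y')) _)) ⟩
  sumℚ (allΔsym b) (λ y → χ (sameSym y y') * sumℚ (allΔ B) (λ v → χ (sameWord v t) * g (y , v)))
    ≡⟨ sumℚ-cong (allΔsym b) (λ y → cong (χ (sameSym y y') *_) (sumℚ-allΔ-δ B t (λ v → g (y , v)))) ⟩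
  sumℚ (allΔsym b) (λ y → χ (sameSym y y') * g (y , t))
    ≡⟨ sumℚ-allΔsym-δ b y' (λ y → g (y , t)) ⟩
  g (y' , t) ∎
  where
  open ≡-Reasoning
  split : ∀ y v → χ (sameSym y y' ∧ sameWord v t) * g (y , v) ≡ χ (sameSym y y') * (χ (sameWord v t) * g (y , v))
  split y v = trans (cong (_* g (y , v)) (χ-∧ (sameSym y y') (sameWord v t))) (*-assoc (χ (sameSym y y')) (χ (sameWord v t)) (g (y , v)))

patternSum-ζ-∷ : ∀ {ℓ b} (B : Vec ℕ ℓ) (y y' : Δsym b) (v v' : ΔW B) →
                 patternSum (b ∷ B) (ζ (y' , v')) (y , v) ≡ sumℚ (allFin b) (λ a → χ (matches₁ a y) * ν (just a) y') * patternSum B (ζ v') v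
patternSum-ζ-∷ {b = b} B y y' v v' =
  trans (sumℚ-cong (allΣ (b ∷ B)) (λ { (a , w) → trans (cong (_* (ν (just a) y' * ζ v' w)) (χ-matches-∷ a w y v))
                                                      (interchange-* (χ (matches₁ a y)) (χ (matches w v)) (ν (just a) y') (ζ v' w)) }))
        (sumℚ-cartesian-* (allFin b) (allΣ B) (λ a → χ (matches₁ a y) * ν (just a) y') (λ w → χ (matches w v) * ζ v' w))

patternSum-ζ : ∀ {ℓ} (B : Vec ℕ ℓ) (v v' : ΔW B) → nGaps v' < nGaps v → patternSum B (ζ v') v ≡ 0ℚ
patternSum-ζ (b ∷ B) (y , v) (y' , v') gaps< = trans (patternSum-ζ-∷ B y y' v v') (vanish y y' gaps<)
  where
  first : Δsym b → Δsym b → ℚ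
  first y y' = sumℚ (allFin b) (λ a → χ (matches₁ a y) * ν (just a) y')
  vanish : (y y' : Δsym b) → nGaps {B = b ∷ B} (y' , v') < nGaps {B = b ∷ B} (y , v) →
           first y y' * patternSum B (ζ v') v ≡ 0ℚ
  vanish nothing  (just c)  _           = trans (cong (_* patternSum B (ζ v') v) column) (*-zeroˡ (patternSum B (ζ v') v))
    where
    column : sumℚ (allFin b) (λ a → 1ℚ * ν (just a) (just c)) ≡ 0ℚ
    column = trans (sumℚ-cong (allFin b) (λ a → *-identityˡ _)) (ν-column-sum c)
  vanish nothing  nothing   (s≤s gaps<) = *-zeroʳ-≡ (first nothing nothing) (patternSum-ζ B v v' gaps<)
  vanish (just c) nothing   gaps<       = *-zeroʳ-≡ (first (just c) nothing) (patternSum-ζ B v v' (ℕP.<-trans (ℕP.n<1+n _) gaps<))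
  vanish (just c) (just c') gaps<       = *-zeroʳ-≡ (first (just c) (just c')) (patternSum-ζ B v v' gaps<)

patternSum-just : ∀ {ℓ b} (B : Vec ℕ ℓ) (x : VecΣ (b ∷ B)) (a : Fin b) (d : ΔW B) →
                  patternSum (b ∷ B) x (just a , d) ≡ patternSum B (λ w → x (a , w)) d
patternSum-just B x a d = sumℚ-allΣ-head a (λ w → matches w d) x

patternSum-gap : ∀ {ℓ b} (B : Vec ℕ ℓ) (x : VecΣ (b ∷ B)) (d : ΔW B) →
                 patternSum (b ∷ B) x (nothing , d) ≡ sumℚ (allFin b) (λ a → patternSum B (λ w → x (a , w)) d)
patternSum-gap {b = b} B x d = sumℚ-cartesian (allFin b) (allΣ B) _

fillFirstGap : ∀ {ℓ} {B : Vec ℕ ℓ} → ΔW B → List (ΔW B)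
fillFirstGap {B = []}    tt           = []
fillFirstGap {B = b ∷ B} (nothing , d) = map (λ a → just a , d) (allFin b)
fillFirstGap {B = b ∷ B} (just a , d)  = map (λ e → just a , e) (fillFirstGap d)

fillFirstGap-nGaps : ∀ {ℓ} {B : Vec ℕ ℓ} (d e : ΔW B) → e ∈ fillFirstGap d → suc (nGaps e) ≡ nGaps d
fillFirstGap-nGaps {B = b ∷ B} (nothing , d) e e∈ with ∈-map⁻ (λ a → just a , d) e∈
... | _ , _ , refl = refl
fillFirstGap-nGaps {B = b ∷ B} (just a , d)  e e∈ with ∈-map⁻ (λ e → just a , e) e∈
... | e' , e'∈ , refl = fillFirstGap-nGaps d e' e'∈

patternSum-fillFirstGap : ∀ {ℓ} (B : Vec ℕ ℓ) (x : VecΣ B) (d : ΔW B) → 1 ≤ nGaps d →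
                          patternSum B x d ≡ sumℚ (fillFirstGap d) (patternSum B x)
patternSum-fillFirstGap (b ∷ B) x (nothing , d) _ = begin
  patternSum (b ∷ B) x (nothing , d)                                 ≡⟨ patternSum-gap B x d ⟩
  sumℚ (allFin b) (λ a → patternSum B (λ w → x (a , w)) d)           ≡⟨ sumℚ-cong (allFin b) (λ a → sym (patternSum-just B x a d)) ⟩
  sumℚ (allFin b) (λ a → patternSum (b ∷ B) x (just a , d))          ≡⟨ sym (sumℚ-map (λ a → just a , d) (allFin b) (patternSum (b ∷ B) x)) ⟩
  sumℚ (fillFirstGap (nothing , d)) (patternSum (b ∷ B) x)           ∎
  where open ≡-Reasoning
patternSum-fillFirstGap (b ∷ B) x (just a , d) gap = begin
  patternSum (b ∷ B) x (just a , d)                                  ≡⟨ patternSum-just B x a d ⟩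
  patternSum B (λ w → x (a , w)) d                                   ≡⟨ patternSum-fillFirstGap B (λ w → x (a , w)) d gap ⟩
  sumℚ (fillFirstGap d) (patternSum B (λ w → x (a , w)))             ≡⟨ sumℚ-cong (fillFirstGap d) (λ e → sym (patternSum-just B x a e)) ⟩
  sumℚ (fillFirstGap d) (λ e → patternSum (b ∷ B) x (just a , e))    ≡⟨ sym (sumℚ-map (λ e → just a , e) (fillFirstGap d) (patternSum (b ∷ B) x)) ⟩
  sumℚ (fillFirstGap (just a , d)) (patternSum (b ∷ B) x)            ∎
  where open ≡-Reasoning

patternSum-vanishes-above : ∀ {ℓ} (B : Vec ℕ ℓ) (x : VecΣ B) (t : ℕ) →
                            (∀ d → nGaps d ≡ t → patternSum B x d ≡ 0ℚ) →
                            ∀ d → t ≤ nGaps d → patternSum B x d ≡ 0ℚ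
patternSum-vanishes-above B x t vanish d t≤gaps = above (nGaps d ∸ t) d (sym (ℕP.m∸n+n≡m t≤gaps))
  where
  above : ∀ m d → nGaps d ≡ m ℕ.+ t → patternSum B x d ≡ 0ℚ
  above zero    d gaps≡ = vanish d gaps≡
  above (suc m) d gaps≡ =
    trans (patternSum-fillFirstGap B x d (subst (1 ≤_) (sym gaps≡) (s≤s z≤n)))
          (sumℚ-zero-∈ (fillFirstGap d) (λ e e∈ → above m e (ℕP.suc-injective (trans (fillFirstGap-nGaps d e e∈) gaps≡))))

ζ-coeff₁ : ∀ {b} → Δsym b → Δsym b → ℚ
ζ-coeff₁ nothing  nothing  = 1ℚ
ζ-coeff₁ nothing  (just _) = 0ℚ
ζ-coeff₁ (just _) nothing  = 0ℚ
ζ-coeff₁ (just c) (just t) = ν (just t) (just c)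

ζ-coeff : ∀ {ℓ} {B : Vec ℕ ℓ} → ΔW B → ΔW B → ℚ
ζ-coeff {B = []}    tt      tt      = 1ℚ
ζ-coeff {B = b ∷ B} (y , v) (t , d) = ζ-coeff₁ y t * ζ-coeff v d

⌊≟⌋-sym : ∀ {b} (a a' : Fin b) → ⌊ a FP.≟ a' ⌋ ≡ ⌊ a' FP.≟ a ⌋
⌊≟⌋-sym a a' with a FP.≟ a' | a' FP.≟ a
... | yes _    | yes _    = refl
... | no _     | no _     = refl
... | yes refl | no a≢a   = ⊥-elim (a≢a refl)
... | no a≢a   | yes refl = ⊥-elim (a≢a refl)

ν-as-patterns : ∀ {b} (a : Fin b) (y : Δsym b) → ν (just a) y ≡ sumℚ (allΔsym b) (λ t → ζ-coeff₁ y t * χ (matches₁ a t))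
ν-as-patterns {b} a nothing = sym (begin
  1ℚ * 1ℚ + sumℚ (map just (allFin b)) (λ t → ζ-coeff₁ nothing t * χ (matches₁ a t))
    ≡⟨ cong (1ℚ * 1ℚ +_) (trans (sumℚ-map just (allFin b) _) (sumℚ-zero (allFin b) (λ a' → *-zeroˡ (χ ⌊ a FP.≟ a' ⌋)))) ⟩
  1ℚ * 1ℚ + 0ℚ                          ≡⟨ trans (+-identityʳ _) (*-identityˡ 1ℚ) ⟩
  1ℚ                                    ≡⟨ sym (ν-gap a) ⟩
  ν (just a) nothing                    ∎)
  where open ≡-Reasoning
ν-as-patterns {b} a (just c) = sym (begin
  0ℚ * 1ℚ + sumℚ (map just (allFin b)) (λ t → ζ-coeff₁ (just c) t * χ (matches₁ a t))
    ≡⟨ trans (cong₂ _+_ (*-zeroˡ 1ℚ) (sumℚ-map just (allFin b) _)) (+-identityˡ _) ⟩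
  sumℚ (allFin b) (λ a' → ν (just a') (just c) * χ ⌊ a FP.≟ a' ⌋)
    ≡⟨ sumℚ-cong (allFin b) (λ a' → trans (*-comm (ν (just a') (just c)) (χ ⌊ a FP.≟ a' ⌋)) (cong (λ e → χ e * ν (just a') (just c)) (⌊≟⌋-sym a a'))) ⟩
  sumℚ (allFin b) (λ a' → χ ⌊ a' FP.≟ a ⌋ * ν (just a') (just c))
    ≡⟨ sumℚ-allFin-δ b a (λ a' → ν (just a') (just c)) ⟩
  ν (just a) (just c)                   ∎)
  where open ≡-Reasoning

ζ-as-patterns : ∀ {ℓ} (B : Vec ℕ ℓ) (w : ΣW B) (v : ΔW B) → ζ v w ≡ sumℚ (allΔ B) (λ d → ζ-coeff v d * χ (matches w d))
ζ-as-patterns []      tt      tt      = sym (trans (+-identityʳ _) (*-identityˡ 1ℚ))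
ζ-as-patterns (b ∷ B) (a , w) (y , v) = begin
  ν (just a) y * ζ v w
    ≡⟨ cong₂ _*_ (ν-as-patterns a y) (ζ-as-patterns B w v) ⟩
  sumℚ (allΔsym b) (λ t → ζ-coeff₁ y t * χ (matches₁ a t)) * sumℚ (allΔ B) (λ d → ζ-coeff v d * χ (matches w d))
    ≡⟨ sym (sumℚ-cartesian-* (allΔsym b) (allΔ B) (λ t → ζ-coeff₁ y t * χ (matches₁ a t)) (λ d → ζ-coeff v d * χ (matches w d))) ⟩
  sumℚ (allΔ (b ∷ B)) (λ p → (ζ-coeff₁ y (proj₁ p) * χ (matches₁ a (proj₁ p))) * (ζ-coeff v (proj₂ p) * χ (matches w (proj₂ p))))
    ≡⟨ sumℚ-cong (allΔ (b ∷ B)) (λ { (t , d) → trans (interchange-* (ζ-coeff₁ y t) _ (ζ-coeff v d) _)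
                                                       (cong (ζ-coeff₁ y t * ζ-coeff v d *_) (sym (χ-matches-∷ a w t d))) }) ⟩
  sumℚ (allΔ (b ∷ B)) (λ p → ζ-coeff (y , v) p * χ (matches (a , w) p)) ∎
  where open ≡-Reasoning

ζ-coeff-nGaps : ∀ {ℓ} (B : Vec ℕ ℓ) (v d : ΔW B) → ζ-coeff v d ≡ 0ℚ ⊎ nGaps d ≡ nGaps v
ζ-coeff-nGaps []      tt            tt            = inj₂ refl
ζ-coeff-nGaps (b ∷ B) (nothing , v) (nothing , d) with ζ-coeff-nGaps B v d
... | inj₁ c≡0 = inj₁ (*-zeroʳ-≡ 1ℚ c≡0)
... | inj₂ eq  = inj₂ (cong suc eq)
ζ-coeff-nGaps (b ∷ B) (nothing , v) (just _ , d)  = inj₁ (*-zeroˡ (ζ-coeff v d))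
ζ-coeff-nGaps (b ∷ B) (just _ , v)  (nothing , d) = inj₁ (*-zeroˡ (ζ-coeff v d))
ζ-coeff-nGaps (b ∷ B) (just y , v)  (just t , d) with ζ-coeff-nGaps B v d
... | inj₁ c≡0 = inj₁ (*-zeroʳ-≡ (ν (just t) (just y)) c≡0)
... | inj₂ eq  = inj₂ eq

inner : ∀ {ℓ} (B : Vec ℕ ℓ) → VecΣ B → VecΣ B → ℚ
inner B x y = sumℚ (allΣ B) (λ u → x u * y u)

inner-ζ-vanishes : ∀ {ℓ} (B : Vec ℕ ℓ) (x : VecΣ B) (t : ℕ) → (∀ d → t ≤ nGaps d → patternSum B x d ≡ 0ℚ) →
                   ∀ v → t ≤ nGaps v → inner B x (ζ v) ≡ 0ℚ
inner-ζ-vanishes B x t vanish v t≤gaps = begin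
  sumℚ (allΣ B) (λ w → x w * ζ v w)
    ≡⟨ sumℚ-cong (allΣ B) (λ w → trans (cong (x w *_) (ζ-as-patterns B w v)) (sym (sumℚ-*ˡ (allΔ B) (x w) _))) ⟩
  sumℚ (allΣ B) (λ w → sumℚ (allΔ B) (λ d → x w * (ζ-coeff v d * χ (matches w d))))
    ≡⟨ sumℚ-swap (allΣ B) (allΔ B) _ ⟩
  sumℚ (allΔ B) (λ d → sumℚ (allΣ B) (λ w → x w * (ζ-coeff v d * χ (matches w d))))
    ≡⟨ sumℚ-cong (allΔ B) (λ d → trans (sumℚ-cong (allΣ B) (λ w → regroup (x w) (ζ-coeff v d) (χ (matches w d))))
                                       (sumℚ-*ˡ (allΣ B) (ζ-coeff v d) _)) ⟩
  sumℚ (allΔ B) (λ d → ζ-coeff v d * patternSum B x d)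
    ≡⟨ sumℚ-zero (allΔ B) term≡0 ⟩
  0ℚ ∎
  where
  open ≡-Reasoning
  regroup : ∀ p c m → p * (c * m) ≡ c * (m * p)
  regroup = solve-∀ ℚ-ring
  term≡0 : ∀ d → ζ-coeff v d * patternSum B x d ≡ 0ℚ
  term≡0 d with ζ-coeff-nGaps B v d
  ... | inj₁ c≡0 = trans (cong (_* patternSum B x d) c≡0) (*-zeroˡ (patternSum B x d))
  ... | inj₂ eq  = *-zeroʳ-≡ (ζ-coeff v d) (vanish d (subst (t ≤_) (sym eq) t≤gaps))

AtA-apply : ∀ {ℓ} k (B : Vec ℕ ℓ) (y : VecΣ B) (u : ΣW B) →
            sumℚ (allΣ B) (λ w → AtA k B u w * y w) ≡ sumℚ (V k B) (λ v → χ (matches u v) * patternSum B y v)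
AtA-apply k B y u = begin
  sumℚ (allΣ B) (λ w → AtA k B u w * y w)
    ≡⟨ sumℚ-cong (allΣ B) (λ w → sym (sumℚ-*ʳ (V k B) (y w) (λ v → χ (matches u v) * χ (matches w v)))) ⟩
  sumℚ (allΣ B) (λ w → sumℚ (V k B) (λ v → (χ (matches u v) * χ (matches w v)) * y w))
    ≡⟨ sumℚ-swap (allΣ B) (V k B) _ ⟩
  sumℚ (V k B) (λ v → sumℚ (allΣ B) (λ w → (χ (matches u v) * χ (matches w v)) * y w))
    ≡⟨ sumℚ-cong (V k B) (λ v → trans (sumℚ-cong (allΣ B) (λ w → *-assoc (χ (matches u v)) (χ (matches w v)) (y w)))
                                      (sumℚ-*ˡ (allΣ B) (χ (matches u v)) _)) ⟩
  sumℚ (V k B) (λ v → χ (matches u v) * patternSum B y v) ∎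
  where open ≡-Reasoning

InNull⇒patternSum≡0 : ∀ {ℓ} k (B : Vec ℕ ℓ) (x : VecΣ B) → InNull k B x → ∀ v → v ∈ V k B → patternSum B x v ≡ 0ℚ
InNull⇒patternSum≡0 k B x null = sumℚ-squares≡0 (V k B) (patternSum B x) (sym (begin
  0ℚ
    ≡⟨ sym (sumℚ-zero (allΣ B) (λ u → *-zeroʳ-≡ (x u) (null u))) ⟩
  sumℚ (allΣ B) (λ u → x u * sumℚ (allΣ B) (λ w → AtA k B u w * x w))
    ≡⟨ sumℚ-cong (allΣ B) (λ u → trans (cong (x u *_) (AtA-apply k B x u)) (sym (sumℚ-*ˡ (V k B) (x u) _))) ⟩
  sumℚ (allΣ B) (λ u → sumℚ (V k B) (λ v → x u * (χ (matches u v) * patternSum B x v)))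
    ≡⟨ sumℚ-swap (allΣ B) (V k B) _ ⟩
  sumℚ (V k B) (λ v → sumℚ (allΣ B) (λ u → x u * (χ (matches u v) * patternSum B x v)))
    ≡⟨ sumℚ-cong (V k B) (λ v → trans (sumℚ-cong (allΣ B) (λ u → regroup (x u) (χ (matches u v)) (patternSum B x v)))
                                      (sumℚ-*ʳ (allΣ B) (patternSum B x v) _)) ⟩
  sumℚ (V k B) (λ v → patternSum B x v * patternSum B x v) ∎))
  where
  open ≡-Reasoning
  regroup : ∀ a m s → a * (m * s) ≡ (m * a) * s
  regroup = solve-∀ ℚ-ring

∈-allΔ : ∀ {ℓ} (B : Vec ℕ ℓ) (d : ΔW B) → d ∈ allΔ B
∈-allΔ []      tt      = here refl
∈-allΔ (b ∷ B) (y , d) = ∈-cartesianProductWith⁺ _,_ (∈-allΔsym y) (∈-allΔ B d)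
  where
  ∈-allΔsym : (y : Δsym b) → y ∈ allΔsym b
  ∈-allΔsym nothing  = here refl
  ∈-allΔsym (just a) = there (∈-map⁺ just (∈-allFin a))

nGaps≤ℓ : ∀ {ℓ} {B : Vec ℕ ℓ} (v : ΔW B) → nGaps v ≤ ℓ
nGaps≤ℓ {B = []}    tt           = z≤n
nGaps≤ℓ {B = b ∷ B} (nothing , v) = s≤s (nGaps≤ℓ v)
nGaps≤ℓ {B = b ∷ B} (just _ , v)  = ℕP.m≤n⇒m≤1+n (nGaps≤ℓ v)

-- the unique n with v ∈ V'_{ℓ,n;B} (when v ∈ Γ_B)
level : ∀ {ℓ} {B : Vec ℕ ℓ} → ΔW B → ℕ
level {ℓ} v = ℓ ∸ nGaps v

isIndex : ∀ {ℓ} {B : Vec ℕ ℓ} → ℕ → ΔW B → Bool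
isIndex k v = isΓ v ∧ (k <ᵇ level v)

∈-indexSet⁻ : ∀ {ℓ} k (B : Vec ℕ ℓ) n (v' : ΔW B) → (n , v') ∈ indexSet k B →
              k < n × n ≤ ℓ × isΓ v' ≡ true × nGaps v' ≡ ℓ ∸ n
∈-indexSet⁻ {ℓ} k B n v' mem
  with _ , p∈xs , xs∈ ← ∈-concat⁻′ (map (λ n → map (n ,_) (V' n B)) (filter (λ n → T? (k <ᵇ n)) (upTo (suc ℓ)))) mem
  with n₀ , n₀∈ , refl ← ∈-map⁻ (λ n → map (n ,_) (V' n B)) xs∈
  with _ , v'∈ , refl ← ∈-map⁻ (n₀ ,_) p∈xs
  with n₀∈upTo , k<ᵇn₀ ← ∈-filter⁻ (λ n → T? (k <ᵇ n)) {xs = upTo (suc ℓ)} n₀∈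
  with _ , Γ∧gaps ← ∈-filter⁻ (λ v → T? (isΓ v ∧ (nGaps v ≡ᵇ (ℓ ∸ n₀)))) {xs = allΔ B} v'∈
  with isΓ v' | Γ∧gaps
... | true | gaps = ℕP.<ᵇ⇒< k n₀ k<ᵇn₀ , ℕP.≤-pred (∈-upTo⁻ n₀∈upTo) , refl , ℕP.≡ᵇ⇒≡ _ _ gaps

level-indexSet : ∀ {ℓ} k (B : Vec ℕ ℓ) n (v' : ΔW B) → (n , v') ∈ indexSet k B → level v' ≡ n
level-indexSet {ℓ} k B n v' mem with ∈-indexSet⁻ k B n v' mem
... | _ , n≤ℓ , _ , gaps = trans (cong (ℓ ∸_) gaps) (ℕP.m∸[m∸n]≡n n≤ℓ)

≡ᵇ-∸-swap : ∀ {ℓ g n} → g ≤ ℓ → n ≤ ℓ → (g ≡ᵇ ℓ ∸ n) ≡ (n ≡ᵇ ℓ ∸ g)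
≡ᵇ-∸-swap {ℓ} {g} {n} g≤ℓ n≤ℓ with n ℕ.≟ ℓ ∸ g
... | yes refl = trans (cong (g ≡ᵇ_) (ℕP.m∸[m∸n]≡n g≤ℓ)) (trans (≡ᵇ-refl g) (sym (≡ᵇ-refl (ℓ ∸ g))))
... | no n≢ℓ∸g = trans (≢⇒≡ᵇ-false {g} {ℓ ∸ n} (λ g≡ℓ∸n → n≢ℓ∸g (trans (sym (ℕP.m∸[m∸n]≡n n≤ℓ)) (cong (ℓ ∸_) (sym g≡ℓ∸n)))))
                       (sym (≢⇒≡ᵇ-false n≢ℓ∸g))

sumℚ-level : ∀ {ℓ} {B : Vec ℕ ℓ} (v : ΔW B) (G : ℕ → ℚ) →
             sumℚ (upTo (suc ℓ)) (λ n → χ (nGaps v ≡ᵇ ℓ ∸ n) * G n) ≡ G (level v)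
sumℚ-level {ℓ} v G = trans
  (sumℚ-cong-∈ (upTo (suc ℓ)) (λ n n∈ → cong (λ e → χ e * G n) (≡ᵇ-∸-swap (nGaps≤ℓ v) (ℕP.≤-pred (∈-upTo⁻ n∈)))))
  (sumℚ-upTo-δ (suc ℓ) (level v) G (s≤s (ℕP.m∸n≤m ℓ (nGaps v))))

sumℚ-indexSet : ∀ {ℓ} k (B : Vec ℕ ℓ) (F : ℕ × ΔW B → ℚ) →
                sumℚ (indexSet k B) F ≡ sumℚ (allΔ B) (λ v → χ (isIndex k v) * F (level v , v))
sumℚ-indexSet {ℓ} k B F = begin
  sumℚ (indexSet k B) F
    ≡⟨ sumℚ-concatMap (λ n → map (n ,_) (V' n B)) levels F ⟩
  sumℚ levels (λ n → sumℚ (map (n ,_) (V' n B)) F)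
    ≡⟨ sumℚ-cong levels (λ n → trans (sumℚ-map (n ,_) (V' n B) F) (sumℚ-filter (λ v → T? (isΓ v ∧ (nGaps v ≡ᵇ ℓ ∸ n))) (allΔ B) _)) ⟩
  sumℚ levels (λ n → sumℚ (allΔ B) (λ v → χ (isΓ v ∧ (nGaps v ≡ᵇ ℓ ∸ n)) * F (n , v)))
    ≡⟨ sumℚ-filter (λ n → T? (k <ᵇ n)) (upTo (suc ℓ)) _ ⟩
  sumℚ (upTo (suc ℓ)) (λ n → χ (k <ᵇ n) * sumℚ (allΔ B) (λ v → χ (isΓ v ∧ (nGaps v ≡ᵇ ℓ ∸ n)) * F (n , v)))
    ≡⟨ sumℚ-cong (upTo (suc ℓ)) (λ n → sym (sumℚ-*ˡ (allΔ B) (χ (k <ᵇ n)) _)) ⟩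
  sumℚ (upTo (suc ℓ)) (λ n → sumℚ (allΔ B) (λ v → χ (k <ᵇ n) * (χ (isΓ v ∧ (nGaps v ≡ᵇ ℓ ∸ n)) * F (n , v))))
    ≡⟨ sumℚ-swap (upTo (suc ℓ)) (allΔ B) _ ⟩
  sumℚ (allΔ B) (λ v → sumℚ (upTo (suc ℓ)) (λ n → χ (k <ᵇ n) * (χ (isΓ v ∧ (nGaps v ≡ᵇ ℓ ∸ n)) * F (n , v))))
    ≡⟨ sumℚ-cong (allΔ B) pick ⟩
  sumℚ (allΔ B) (λ v → χ (isIndex k v) * F (level v , v)) ∎
  where
  open ≡-Reasoning
  levels = filter (λ n → T? (k <ᵇ n)) (upTo (suc ℓ))
  pick : ∀ v → sumℚ (upTo (suc ℓ)) (λ n → χ (k <ᵇ n) * (χ (isΓ v ∧ (nGaps v ≡ᵇ ℓ ∸ n)) * F (n , v))) ≡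
               χ (isIndex k v) * F (level v , v)
  pick v with isΓ v
  ... | false = trans (sumℚ-zero (upTo (suc ℓ)) (λ n → *-zeroʳ-≡ (χ (k <ᵇ n)) (*-zeroˡ (F (n , v)))))
                      (sym (*-zeroˡ (F (level v , v))))
  ... | true  = trans (sumℚ-cong (upTo (suc ℓ)) (λ n → *-comm-middle (χ (k <ᵇ n)) (χ (nGaps v ≡ᵇ ℓ ∸ n)) (F (n , v))))
                      (sumℚ-level v (λ n → χ (k <ᵇ n) * F (n , v)))
    where
    *-comm-middle : ∀ a b c → a * (b * c) ≡ b * (a * c)
    *-comm-middle = solve-∀ ℚ-ring

lincomb-as-sum : ∀ {ℓ} k (B : Vec ℕ ℓ) (c : ℕ → ΔW B → ℚ) (u : ΣW B) →
                 lincomb k B c u ≡ sumℚ (allΔ B) (λ v → (χ (isIndex k v) * c (level v) v) * ζ v u)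
lincomb-as-sum k B c u =
  trans (sumℚ-indexSet k B _) (sumℚ-cong (allΔ B) (λ v → sym (*-assoc (χ (isIndex k v)) (c (level v) v) (ζ v u))))

φ-zero : ∀ i → φ i 0 ≡ 0ℚ
φ-zero zero    = refl
φ-zero (suc i) = φ-> {suc i} (s≤s z≤n)

ζ-nonΓ : ∀ {ℓ} {B : Vec ℕ ℓ} (v : ΔW B) (u : ΣW B) → isΓ v ≡ false → ζ v u ≡ 0ℚ
ζ-nonΓ {B = b ∷ B} (nothing , v) (a , u) notΓ = *-zeroʳ-≡ (ν (just a) nothing) (ζ-nonΓ v u notΓ)
ζ-nonΓ {B = b ∷ B} (just c , v)  (a , u) notΓ with toℕ c ≡ᵇ 0 in c≡ᵇ0
... | true  = trans (cong (_* ζ v u) ν≡0) (*-zeroˡ (ζ v u))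
  where
  ν≡0 : ν (just a) (just c) ≡ 0ℚ
  ν≡0 = trans (ν-just a (just c)) (trans (cong (φ (toℕ a)) (ℕP.≡ᵇ⇒≡ _ _ (subst T (sym c≡ᵇ0) tt))) (φ-zero (toℕ a)))
... | false = *-zeroʳ-≡ (ν (just a) (just c)) (ζ-nonΓ v u notΓ)

ℕtoℚ*ℕtoℚ-suc≢0 : ∀ j → not (j ≡ᵇ 0) ≡ true → ℕtoℚ j * ℕtoℚ (suc j) ≢ 0ℚ
ℕtoℚ*ℕtoℚ-suc≢0 (suc j) _ eq with p*q≡0⇒p≡0∨q≡0 (ℕtoℚ (suc j)) (ℕtoℚ (suc (suc j))) eq
... | inj₁ e = ℕtoℚ-suc≢0 j e
... | inj₂ e = ℕtoℚ-suc≢0 (suc j) e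

isΓ₁ : ∀ {b} → Δsym b → Bool
isΓ₁ nothing  = true
isΓ₁ (just c) = not (toℕ c ≡ᵇ 0)

isΓ-∷ : ∀ {ℓ b} {B : Vec ℕ ℓ} (y : Δsym b) (w : ΔW B) → isΓ {B = b ∷ B} (y , w) ≡ isΓ₁ y ∧ isΓ w
isΓ-∷ nothing  w = refl
isΓ-∷ (just c) w = refl

normSq₁≢0 : ∀ {b} → 1 ≤ b → (y : Δsym b) → isΓ₁ y ≡ true → normSq₁ b y ≢ 0ℚ
normSq₁≢0 {suc b} _ nothing  _  = ℕtoℚ-suc≢0 b
normSq₁≢0         _ (just c) Γc = ℕtoℚ*ℕtoℚ-suc≢0 (toℕ c) Γc

normSq≢0 : ∀ {ℓ} {B : Vec ℕ ℓ} → All (1 ≤_) B → (w : ΔW B) → isΓ w ≡ true → normSq w ≢ 0ℚ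
normSq≢0 {B = []}    []          tt      _   ()
normSq≢0 {B = b ∷ B} (1≤b ∷ 1≤B) (y , w) Γyw eq with p*q≡0⇒p≡0∨q≡0 (normSq₁ b y) (normSq w) eq
... | inj₁ N₁≡0 = normSq₁≢0 1≤b y (BP.∧-conicalˡ _ _ (trans (sym (isΓ-∷ y w)) Γyw)) N₁≡0
... | inj₂ N≡0  = normSq≢0 1≤B w (BP.∧-conicalʳ _ _ (trans (sym (isΓ-∷ y w)) Γyw)) N≡0

z-inNull : ∀ {ℓ} k (B : Vec ℕ ℓ) n (v' : ΔW B) → (n , v') ∈ indexSet k B → InNull k B (z n v')
z-inNull {ℓ} k B n v' v'∈ u with ∈-indexSet⁻ k B n v' v'∈
... | k<n , n≤ℓ , _ , gaps≡ =
  trans (AtA-apply k B (ζ v') u)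
        (sumℚ-zero-∈ (V k B) (λ v v∈V → *-zeroʳ-≡ (χ (matches u v)) (patternSum-ζ B v v' (fewerGaps v v∈V))))
  where
  fewerGaps : ∀ v → v ∈ V k B → nGaps v' < nGaps v
  fewerGaps v v∈V = subst₂ _<_ (sym gaps≡) (sym (proj₂ (∈-filter⁻ (λ v → nGaps v ℕ.≟ (ℓ ∸ k)) {xs = allΔ B} v∈V)))
                           (ℕP.∸-monoʳ-< k<n n≤ℓ)

inner-ζ-combination : ∀ {ℓ} (B : Vec ℕ ℓ) (F : ΔW B → ℚ) (w : ΔW B) →
                      inner B (ζ w) (λ u → sumℚ (allΔ B) (λ v → F v * ζ v u)) ≡ F w * normSq w
inner-ζ-combination B F w = begin
  sumℚ (allΣ B) (λ u → ζ w u * sumℚ (allΔ B) (λ v → F v * ζ v u))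
    ≡⟨ sumℚ-cong (allΣ B) (λ u → trans (sym (sumℚ-*ˡ (allΔ B) (ζ w u) _)) (sumℚ-cong (allΔ B) (λ v → regroup (ζ w u) (F v) (ζ v u)))) ⟩
  sumℚ (allΣ B) (λ u → sumℚ (allΔ B) (λ v → F v * (ζ v u * ζ w u)))
    ≡⟨ sumℚ-swap (allΣ B) (allΔ B) _ ⟩
  sumℚ (allΔ B) (λ v → sumℚ (allΣ B) (λ u → F v * (ζ v u * ζ w u)))
    ≡⟨ sumℚ-cong (allΔ B) (λ v → trans (sumℚ-*ˡ (allΣ B) (F v) _) (cong (F v *_) (ζ-orthogonal B v w))) ⟩
  sumℚ (allΔ B) (λ v → F v * (χ (sameWord v w) * normSq w))
    ≡⟨ sumℚ-cong (allΔ B) (λ v → *-comm-middle (F v) (χ (sameWord v w)) (normSq w)) ⟩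
  sumℚ (allΔ B) (λ v → χ (sameWord v w) * (F v * normSq w))
    ≡⟨ sumℚ-allΔ-δ B w (λ v → F v * normSq w) ⟩
  F w * normSq w ∎
  where
  open ≡-Reasoning
  regroup : ∀ z f z' → z * (f * z') ≡ f * (z' * z)
  regroup = solve-∀ ℚ-ring
  *-comm-middle : ∀ a b c → a * (b * c) ≡ b * (a * c)
  *-comm-middle = solve-∀ ℚ-ring

isIndex-indexSet : ∀ {ℓ} k (B : Vec ℕ ℓ) n (v' : ΔW B) → (n , v') ∈ indexSet k B → isIndex k v' ≡ true
isIndex-indexSet k B n v' v'∈ with ∈-indexSet⁻ k B n v' v'∈
... | k<n , _ , Γv' , _ =
  trans (cong (_∧ (k <ᵇ level v')) Γv') (<⇒<ᵇ-true (subst (k <_) (sym (level-indexSet k B n v' v'∈)) k<n))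

lincomb≡0⇒coeff*normSq≡0 : ∀ {ℓ} k (B : Vec ℕ ℓ) (c : ℕ → ΔW B → ℚ) → (∀ u → lincomb k B c u ≡ 0ℚ) →
                            ∀ w → (χ (isIndex k w) * c (level w) w) * normSq w ≡ 0ℚ
lincomb≡0⇒coeff*normSq≡0 k B c lincomb≡0 w = begin
  F w * normSq w                                            ≡⟨ sym (inner-ζ-combination B F w) ⟩
  inner B (ζ w) (λ u → sumℚ (allΔ B) (λ v → F v * ζ v u))   ≡⟨ sumℚ-cong (allΣ B) (λ u → cong (ζ w u *_) (sym (lincomb-as-sum k B c u))) ⟩
  inner B (ζ w) (lincomb k B c)                             ≡⟨ sumℚ-zero (allΣ B) (λ u → *-zeroʳ-≡ (ζ w u) (lincomb≡0 u)) ⟩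
  0ℚ                                                        ∎
  where
  open ≡-Reasoning
  F : ΔW B → ℚ
  F v = χ (isIndex k v) * c (level v) v

lincomb-independent : ∀ {ℓ} k (B : Vec ℕ ℓ) → All (1 ≤_) B → (c : ℕ → ΔW B → ℚ) → (∀ u → lincomb k B c u ≡ 0ℚ) →
                      ∀ n (v' : ΔW B) → (n , v') ∈ indexSet k B → c n v' ≡ 0ℚ
lincomb-independent k B 1≤B c lincomb≡0 n v' v'∈
  with _ , _ , Γv' , _ ← ∈-indexSet⁻ k B n v' v'∈
  with p*q≡0⇒p≡0∨q≡0 _ (normSq v') (lincomb≡0⇒coeff*normSq≡0 k B c lincomb≡0 v')
... | inj₂ N≡0 = ⊥-elim (normSq≢0 1≤B v' Γv' N≡0)
... | inj₁ F≡0 = begin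
  c n v'                              ≡⟨ sym (*-identityˡ (c n v')) ⟩
  1ℚ * c n v'                         ≡⟨ cong₂ (λ b m → χ b * c m v') (sym (isIndex-indexSet k B n v' v'∈)) (sym (level-indexSet k B n v' v'∈)) ⟩
  χ (isIndex k v') * c (level v') v'  ≡⟨ F≡0 ⟩
  0ℚ                                  ∎
  where open ≡-Reasoning

ζ-expansion : ∀ {ℓ} (B : Vec ℕ ℓ) (x : VecΣ B) (u : ΣW B) → x u ≡ sumℚ (allΔ B) (λ v → (inner B x (ζ v) * weight v) * ζ v u)
ζ-expansion B x u = begin
  x u
    ≡⟨ sym (sumℚ-allΣ-δ B u x) ⟩
  sumℚ (allΣ B) (λ w → χ (matches w (embed u)) * x w)
    ≡⟨ sumℚ-cong (allΣ B) (λ w → trans (cong (_* x w) (sym (ζ-complete B w u))) (sym (sumℚ-*ʳ (allΔ B) (x w) _))) ⟩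
  sumℚ (allΣ B) (λ w → sumℚ (allΔ B) (λ v → (ζ v w * ζ v u * weight v) * x w))
    ≡⟨ sumℚ-swap (allΣ B) (allΔ B) _ ⟩
  sumℚ (allΔ B) (λ v → sumℚ (allΣ B) (λ w → (ζ v w * ζ v u * weight v) * x w))
    ≡⟨ sumℚ-cong (allΔ B) (λ v → trans (sumℚ-cong (allΣ B) (λ w → regroup (ζ v w) (ζ v u) (weight v) (x w)))
                                       (sumℚ-*ʳ (allΣ B) (weight v * ζ v u) (λ w → x w * ζ v w))) ⟩
  sumℚ (allΔ B) (λ v → inner B x (ζ v) * (weight v * ζ v u))
    ≡⟨ sumℚ-cong (allΔ B) (λ v → sym (*-assoc (inner B x (ζ v)) (weight v) (ζ v u))) ⟩
  sumℚ (allΔ B) (λ v → (inner B x (ζ v) * weight v) * ζ v u) ∎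
  where
  open ≡-Reasoning
  regroup : ∀ z z' W X → (z * z' * W) * X ≡ (X * z) * (W * z')
  regroup = solve-∀ ℚ-ring

InNull⇒inner-ζ≡0 : ∀ {ℓ} k (B : Vec ℕ ℓ) (x : VecΣ B) → InNull k B x → ∀ v → ℓ ∸ k ≤ nGaps v → inner B x (ζ v) ≡ 0ℚ
InNull⇒inner-ζ≡0 {ℓ} k B x null = inner-ζ-vanishes B x (ℓ ∸ k) (patternSum-vanishes-above B x (ℓ ∸ k) onRows)
  where
  onRows : ∀ d → nGaps d ≡ ℓ ∸ k → patternSum B x d ≡ 0ℚ
  onRows d gaps≡ = InNull⇒patternSum≡0 k B x null d (∈-filter⁺ (λ v → nGaps v ℕ.≟ (ℓ ∸ k)) (∈-allΔ B d) gaps≡)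

¬isIndex-level⇒ : ∀ {ℓ} k {B : Vec ℕ ℓ} (v : ΔW B) → (k <ᵇ level v) ≡ false → ℓ ∸ k ≤ nGaps v
¬isIndex-level⇒ {ℓ} k v k≮ᵇlevel =
  subst (ℓ ∸ k ≤_) (ℕP.m∸[m∸n]≡n (nGaps≤ℓ v)) (ℕP.∸-monoʳ-≤ ℓ (ℕP.≮⇒≥ k≮level))
  where
  k≮level : ¬ (k < level v)
  k≮level k<level with trans (sym (<⇒<ᵇ-true k<level)) k≮ᵇlevel
  ... | ()

InNull⇒expansion-term : ∀ {ℓ} k (B : Vec ℕ ℓ) (x : VecΣ B) → InNull k B x → ∀ u v →
                        (inner B x (ζ v) * weight v) * ζ v u ≡ (χ (isIndex k v) * (inner B x (ζ v) * weight v)) * ζ v u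
InNull⇒expansion-term k B x null u v with isΓ v in Γv
... | false = trans (*-zeroʳ-≡ (inner B x (ζ v) * weight v) (ζ-nonΓ v u Γv)) (sym (*-zeroʳ-≡ (0ℚ * (inner B x (ζ v) * weight v)) (ζ-nonΓ v u Γv)))
... | true with k <ᵇ level v in k<ᵇlevel
...   | true  = cong (_* ζ v u) (sym (*-identityˡ (inner B x (ζ v) * weight v)))
...   | false = trans (cong (λ p → p * weight v * ζ v u) (InNull⇒inner-ζ≡0 k B x null v (¬isIndex-level⇒ k v k<ᵇlevel)))
                      (trans (*-zeroˡ₃ (weight v) (ζ v u) refl) (sym (*-zeroˡ₃ (inner B x (ζ v) * weight v) (ζ v u) refl)))

InNull⇒spanned : ∀ {ℓ} k (B : Vec ℕ ℓ) (x : VecΣ B) → InNull k B x → ∃ λ (c : ℕ → ΔW B → ℚ) → ∀ u → x u ≡ lincomb k B c u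
InNull⇒spanned k B x null = c , λ u → begin
  x u                                                          ≡⟨ ζ-expansion B x u ⟩
  sumℚ (allΔ B) (λ v → c (level v) v * ζ v u)                  ≡⟨ sumℚ-cong (allΔ B) (InNull⇒expansion-term k B x null u) ⟩
  sumℚ (allΔ B) (λ v → (χ (isIndex k v) * c (level v) v) * ζ v u) ≡⟨ sym (lincomb-as-sum k B c u) ⟩
  lincomb k B c u                                              ∎
  where
  open ≡-Reasoning
  c : ℕ → ΔW B → ℚ
  c _ v = inner B x (ζ v) * weight v

corollary1 : (ℓ k : ℕ) (B : Vec ℕ ℓ) → 1 ≤ ℓ → k ≤ ℓ → All (2 ≤_) B →
    -- every z^{ℓ,n}_{v'} (k < n ≤ ℓ, v' ∈ V'_{ℓ,n;B}) lies in the null space of AᵀA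
    ((n : ℕ) (v' : ΔW B) → (n , v') ∈ indexSet k B → InNull k B (z n v'))
    -- the family is linearly independent over ℚ
    × ((c : ℕ → ΔW B → ℚ) → (∀ u → lincomb k B c u ≡ 0ℚ) →
         (n : ℕ) (v' : ΔW B) → (n , v') ∈ indexSet k B → c n v' ≡ 0ℚ)
    -- the family spans the null space of AᵀA
    × ((x : VecΣ B) → InNull k B x →
         ∃ λ (c : ℕ → ΔW B → ℚ) → ∀ u → x u ≡ lincomb k B c u)
corollary1 ℓ k B _ _ 2≤B =
  z-inNull k B ,
  lincomb-independent k B (AllV.map (ℕP.≤-trans (ℕP.n≤1+n 1)) 2≤B) ,
  InNull⇒spanned k B
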